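{- Let $R=\{t_1,\ldots,t_k\}$ be a simple semi-Thue system over a finite alphabet $\Sigma$ containing two distinct symbols $0,1$, and let $\bullet,*,\#,\$,l,r$ be distinct type atoms not in $\Sigma$ (the type atoms are the elements of $\Sigma\cup\{\bullet,*,\#,\$,l,r\}$). Define $\sigma_*=((\bullet\to *)\to *)\cap((l\to *)\to\#)\cap((r\to\#)\cap(\bullet\to\$)\to\$)$, $\sigma_0=((\bullet\to 0)\to *)\cap((l\to 0)\to\#)\cap((r\to 0)\to\$)$, $\sigma_1=1$, $\sigma_{ab\Rightarrow cd}=(l\to c\to a)\cap(r\to d\to b)\cap\bigcap_{e\in\Sigma}(\bullet\to e\to e)$ for each rule $ab\Rightarrow cd\in R$, $\tau_\star=\sigma_0\to\sigma_*\to\sigma_1\to\sigma_{t_1}\to\cdots\to\sigma_{t_k}\to(l\to *)\cap(r\to\#)\cap(\bullet\to\$)$. Then there exists a $\lambda$-term $M$ with $\vdash M:\tau_\star$ if and only if there exists a positive integer $n$ such that $0^n\twoheadrightarrow_R 1^n$.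
   Context: A simple semi-Thue system over $\Sigma$ is a finite set of rules $ab\Rightarrow cd$ with $a,b,c,d\in\Sigma$; a word $xaby$ rewrites in one step to $xcdy$, and $\twoheadrightarrow_R$ is the reflexive-transitive closure. Intersection types: $\sigma,\tau::=\alpha\mid\sigma\to\tau\mid\sigma\cap\tau$ for atoms $\alpha$, $\to$ right-associative, $\cap$ binds stronger than $\to$ and is idempotent, commutative, associative. $\lambda$-terms $M::=x\mid\lambda x.M\mid MN$, typed by: (Ax) $\Gamma,x:\sigma\vdash x:\sigma$; ($\to$I) from $\Gamma,x:\sigma\vdash M:\tau$ infer $\Gamma\vdash\lambda x.M:\sigma\to\tau$; ($\to$E) from $\Gamma\vdash M:\sigma\to\tau$ and $\Gamma\vdash N:\sigma$ infer $\Gamma\vdash MN:\tau$; ($\cap$I) from $\Gamma\vdash M:\sigma$ and $\Gamma\vdash M:\tau$ infer $\Gamma\vdash M:\sigma\cap\tau$; ($\cap$E) from $\Gamma\vdash M:\sigma\cap\tau$ infer $\Gamma\vdash M:\sigma$. -}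

module Defs where

open import Data.Nat using (ℕ; zero; suc)
open import Data.Fin using (Fin; zero; suc)
open import Data.List using (List; []; _∷_; _++_; replicate)
open import Data.Vec using (Vec; []; _∷_; lookup)
open import Data.Product using (_×_; _,_)
open import Data.List.Membership.Propositional using (_∈_)
open import Relation.Binary.Construct.Closure.ReflexiveTransitive using (Star)

Sym : ℕ → Set
Sym m = Fin (suc m)

-- a rule ab ⇒ cd is the quadruple (a , b , c , d)
Rule : ℕ → Set
Rule m = Sym m × Sym m × Sym m × Sym m

data Step {m : ℕ} (R : List (Rule m)) : List (Sym m) → List (Sym m) → Set where
  step : ∀ {a b c d} (x y : List (Sym m)) →
         (a , b , c , d) ∈ R →
         Step R (x ++ (a ∷ b ∷ y)) (x ++ (c ∷ d ∷ y))

_⊢_↠_ : {m : ℕ} → List (Rule m) → List (Sym m) → List (Sym m) → Set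
R ⊢ u ↠ v = Star (Step R) u v

data Atom (m : ℕ) : Set where
  sym    : Sym m → Atom m
  bullet : Atom m
  star   : Atom m
  hash   : Atom m
  dollar : Atom m
  atl    : Atom m
  atr    : Atom m

infixr 5 _⇒_
infixr 6 _∩_
data Ty (m : ℕ) : Set where
  at  : Atom m → Ty m
  _⇒_ : Ty m → Ty m → Ty m
  _∩_ : Ty m → Ty m → Ty m

-- ∩ is idempotent, commutative, associative: types are taken modulo
-- the congruence generated by these laws
infix 4 _≈_
data _≈_ {m : ℕ} : Ty m → Ty m → Set where
  ≈-refl  : ∀ {σ} → σ ≈ σ
  ≈-sym   : ∀ {σ τ} → σ ≈ τ → τ ≈ σ
  ≈-trans : ∀ {σ τ ρ} → σ ≈ τ → τ ≈ ρ → σ ≈ ρ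
  ⇒-cong  : ∀ {σ σ' τ τ'} → σ ≈ σ' → τ ≈ τ' → σ ⇒ τ ≈ σ' ⇒ τ'
  ∩-cong  : ∀ {σ σ' τ τ'} → σ ≈ σ' → τ ≈ τ' → σ ∩ τ ≈ σ' ∩ τ'
  ∩-idem  : ∀ {σ} → σ ∩ σ ≈ σ
  ∩-comm  : ∀ {σ τ} → σ ∩ τ ≈ τ ∩ σ
  ∩-assoc : ∀ {σ τ ρ} → (σ ∩ τ) ∩ ρ ≈ σ ∩ (τ ∩ ρ)

data Term : ℕ → Set where
  var : ∀ {n} → Fin n → Term n
  lam : ∀ {n} → Term (suc n) → Term n
  app : ∀ {n} → Term n → Term n → Term n

Ctx : ℕ → ℕ → Set
Ctx m n = Vec (Ty m) n

infix 3 _⊢_∶_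
data _⊢_∶_ {m n : ℕ} (Γ : Ctx m n) : Term n → Ty m → Set where
  ax   : ∀ x → Γ ⊢ var x ∶ lookup Γ x
  →I   : ∀ {M σ τ} → (σ ∷ Γ) ⊢ M ∶ τ → Γ ⊢ lam M ∶ σ ⇒ τ
  →E   : ∀ {M N σ τ} → Γ ⊢ M ∶ σ ⇒ τ → Γ ⊢ N ∶ σ → Γ ⊢ app M N ∶ τ
  ∩I   : ∀ {M σ τ} → Γ ⊢ M ∶ σ → Γ ⊢ M ∶ τ → Γ ⊢ M ∶ σ ∩ τ
  ∩E   : ∀ {M σ τ} → Γ ⊢ M ∶ σ ∩ τ → Γ ⊢ M ∶ σ
  conv : ∀ {M σ τ} → Γ ⊢ M ∶ σ → σ ≈ τ → Γ ⊢ M ∶ τ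

⋂ : ∀ {m} (k : ℕ) → (Fin (suc k) → Ty m) → Ty m
⋂ zero    f = f zero
⋂ (suc k) f = f zero ∩ ⋂ k (λ e → f (suc e))

module Encoding {m : ℕ} (s0 s1 : Sym m) where
  ⟨_⟩ : Sym m → Ty m
  ⟨ a ⟩ = at (sym a)
  • * # $ l r : Ty m
  • = at bullet
  * = at star
  # = at hash
  $ = at dollar
  l = at atl
  r = at atr

  σ* : Ty m
  σ* = ((• ⇒ *) ⇒ *) ∩ ((l ⇒ *) ⇒ #) ∩ ((r ⇒ #) ∩ (• ⇒ $) ⇒ $)

  σ0 : Ty m
  σ0 = ((• ⇒ ⟨ s0 ⟩) ⇒ *) ∩ ((l ⇒ ⟨ s0 ⟩) ⇒ #) ∩ ((r ⇒ ⟨ s0 ⟩) ⇒ $)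

  σ1 : Ty m
  σ1 = ⟨ s1 ⟩

  σRule : Rule m → Ty m
  σRule (a , b , c , d) =
    (l ⇒ ⟨ c ⟩ ⇒ ⟨ a ⟩) ∩ (r ⇒ ⟨ d ⟩ ⇒ ⟨ b ⟩) ∩ ⋂ m (λ e → • ⇒ ⟨ e ⟩ ⇒ ⟨ e ⟩)

  rulesTo : List (Rule m) → Ty m → Ty m
  rulesTo []       ρ = ρ
  rulesTo (t ∷ ts) ρ = σRule t ⇒ rulesTo ts ρ

  τ⋆ : List (Rule m) → Ty m
  τ⋆ R = σ0 ⇒ σ* ⇒ σ1 ⇒ rulesTo R ((l ⇒ *) ∩ (r ⇒ #) ∩ (• ⇒ $))

-- Inhabitation is analysed on normal forms: a Kripke logical relation shows that every
-- typable closed term has a normal form typable in a syntax-directed system, in which ∩ and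
-- ≈ are handled by an invertible subtyping relation ≲.
--
-- A normal inhabitant of τ⋆ is λ x0 x* x1 y₁ … y_k b₀. P, and P is typed in three
-- "columns", with b₀ : l, r, • and goals *, #, $.  In general, under markers b₀ … b_{p-1}
-- there are p + 2 columns, with goal * before column p, # in it and $ after it, and column j
-- gives b_i the type l if j = i, r if j = i + 1 and • otherwise.  Only two heads
-- fit all columns: x* (λ b_p. P') adds one column (its third component splits the last one),
-- while x0 (λ b_p. Q) turns the p + 2 columns into the word 0^(p+2), letter j being the type
-- of Q in column j.  From then on the head is either x1, forcing every letter to be 1, or a
-- rule variable y b_i Q' for ab ⇒ cd, which reads a, b in columns i, i + 1, writes c, d
-- there and leaves the other columns alone: one rewrite step.  Conversely, a solution is
-- read back as such a term.

module Submission where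

open import Defs
open import Data.Nat using (ℕ; _≥_)
open import Data.Fin using (Fin)
open import Data.List using (List; replicate)
open import Data.Product using (∃; _×_)
open import Data.Vec using ([])
open import Relation.Binary.PropositionalEquality using (_≢_)
open import Function.Bundles using (_⇔_)

open import Data.Empty using (⊥; ⊥-elim)
open import Data.Fin using (zero; suc; _↑ʳ_)
open import Data.List using ([]; _∷_; _++_; length)
open import Data.List.Membership.Propositional using (_∈_)
open import Data.List.Properties using (++-assoc; length-replicate)
open import Data.List.Relation.Unary.Any using (here; there)
open import Data.Nat using (zero; suc; _+_; _≤_; _<_; s≤s; z≤n; _⊔_)
open import Data.Nat.Properties
  using (_≟_; ≤-refl; ≤-trans; ≤-pred; n≤1+n; n≮n; ≤∧≢⇒<; <⇒≱; m≤m⊔n; m≤n⊔m; ⊔-lub; +-suc; +-monoˡ-≤; +-identityʳ)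
open import Data.Product using (_,_; proj₁; proj₂)
open import Data.Sum using (_⊎_; inj₁; inj₂)
open import Data.Vec using (_∷_; lookup)
open import Function.Bundles using (mk⇔)
open import Relation.Binary.Construct.Closure.ReflexiveTransitive as Star using (ε; _◅_; _◅◅_)
open import Relation.Binary.PropositionalEquality as ≡ using (_≡_; refl; cong; cong₂; trans; subst; subst₂; _≗_)
open import Relation.Nullary using (¬_; yes; no)

module Substitution where

  Ren : ℕ → ℕ → Set
  Ren n n' = Fin n → Fin n'

  liftʳ : ∀ {n n'} → Ren n n' → Ren (suc n) (suc n')
  liftʳ ρ zero = zero
  liftʳ ρ (suc x) = suc (ρ x)

  ren : ∀ {n n'} → Ren n n' → Term n → Term n'
  ren ρ (var x) = var (ρ x)
  ren ρ (lam M) = lam (ren (liftʳ ρ) M)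
  ren ρ (app M N) = app (ren ρ M) (ren ρ N)

  Sub : ℕ → ℕ → Set
  Sub n n' = Fin n → Term n'

  liftˢ : ∀ {n n'} → Sub n n' → Sub (suc n) (suc n')
  liftˢ θ zero = var zero
  liftˢ θ (suc x) = ren suc (θ x)

  sub : ∀ {n n'} → Sub n n' → Term n → Term n'
  sub θ (var x) = θ x
  sub θ (lam M) = lam (sub (liftˢ θ) M)
  sub θ (app M N) = app (sub θ M) (sub θ N)

  infixr 5 _∷ˢ_
  _∷ˢ_ : ∀ {n n'} → Term n' → Sub n n' → Sub (suc n) n'
  (A ∷ˢ θ) zero = A
  (A ∷ˢ θ) (suc x) = θ x

  _[_] : ∀ {n} → Term (suc n) → Term n → Term n
  B [ A ] = sub (A ∷ˢ var) B

  liftʳ-cong : ∀ {n n'} {ρ ρ' : Ren n n'} → ρ ≗ ρ' → liftʳ ρ ≗ liftʳ ρ'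
  liftʳ-cong e zero = refl
  liftʳ-cong e (suc x) = cong suc (e x)

  ren-cong : ∀ {n n'} {ρ ρ' : Ren n n'} → ρ ≗ ρ' → ren ρ ≗ ren ρ'
  ren-cong e (var x) = cong var (e x)
  ren-cong e (lam M) = cong lam (ren-cong (liftʳ-cong e) M)
  ren-cong e (app M N) = cong₂ app (ren-cong e M) (ren-cong e N)

  liftˢ-cong : ∀ {n n'} {θ θ' : Sub n n'} → θ ≗ θ' → liftˢ θ ≗ liftˢ θ'
  liftˢ-cong e zero = refl
  liftˢ-cong e (suc x) = cong (ren suc) (e x)

  sub-cong : ∀ {n n'} {θ θ' : Sub n n'} → θ ≗ θ' → sub θ ≗ sub θ'
  sub-cong e (var x) = e x
  sub-cong e (lam M) = cong lam (sub-cong (liftˢ-cong e) M)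
  sub-cong e (app M N) = cong₂ app (sub-cong e M) (sub-cong e N)

  liftʳ-∘ : ∀ {n n' n''} (ρ : Ren n n') (ρ' : Ren n' n'') →
            (λ x → liftʳ ρ' (liftʳ ρ x)) ≗ liftʳ (λ x → ρ' (ρ x))
  liftʳ-∘ ρ ρ' zero = refl
  liftʳ-∘ ρ ρ' (suc x) = refl

  ren-ren : ∀ {n n' n''} (ρ : Ren n n') (ρ' : Ren n' n'') M →
            ren ρ' (ren ρ M) ≡ ren (λ x → ρ' (ρ x)) M
  ren-ren ρ ρ' (var x) = refl
  ren-ren ρ ρ' (lam M) =
    cong lam (trans (ren-ren (liftʳ ρ) (liftʳ ρ') M) (ren-cong (liftʳ-∘ ρ ρ') M))
  ren-ren ρ ρ' (app M N) = cong₂ app (ren-ren ρ ρ' M) (ren-ren ρ ρ' N)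

  liftʳ-id : ∀ {n} → liftʳ {n} (λ x → x) ≗ (λ x → x)
  liftʳ-id zero = refl
  liftʳ-id (suc x) = refl

  ren-id : ∀ {n} (M : Term n) → ren (λ x → x) M ≡ M
  ren-id (var x) = refl
  ren-id (lam M) = cong lam (trans (ren-cong liftʳ-id M) (ren-id M))
  ren-id (app M N) = cong₂ app (ren-id M) (ren-id N)

  sub-ren : ∀ {n n' n''} (θ : Sub n' n'') (ρ : Ren n n') M →
            sub θ (ren ρ M) ≡ sub (λ x → θ (ρ x)) M
  sub-ren θ ρ (var x) = refl
  sub-ren θ ρ (lam M) =
    cong lam (trans (sub-ren (liftˢ θ) (liftʳ ρ) M) (sub-cong (λ { zero → refl ; (suc x) → refl }) M))
  sub-ren θ ρ (app M N) = cong₂ app (sub-ren θ ρ M) (sub-ren θ ρ N)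

  ren-sub : ∀ {n n' n''} (ρ : Ren n' n'') (θ : Sub n n') M →
            ren ρ (sub θ M) ≡ sub (λ x → ren ρ (θ x)) M
  ren-sub ρ θ (var x) = refl
  ren-sub ρ θ (lam M) = cong lam (trans (ren-sub (liftʳ ρ) (liftˢ θ) M) (sub-cong lift-comm M))
    where
    lift-comm : ∀ x → ren (liftʳ ρ) (liftˢ θ x) ≡ liftˢ (λ y → ren ρ (θ y)) x
    lift-comm zero = refl
    lift-comm (suc x) = trans (ren-ren suc (liftʳ ρ) (θ x)) (≡.sym (ren-ren ρ suc (θ x)))
  ren-sub ρ θ (app M N) = cong₂ app (ren-sub ρ θ M) (ren-sub ρ θ N)

  sub-sub : ∀ {n n' n''} (θ : Sub n n') (θ' : Sub n' n'') M →
            sub θ' (sub θ M) ≡ sub (λ x → sub θ' (θ x)) M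
  sub-sub θ θ' (var x) = refl
  sub-sub θ θ' (lam M) = cong lam (trans (sub-sub (liftˢ θ) (liftˢ θ') M) (sub-cong lift-comm M))
    where
    lift-comm : ∀ x → sub (liftˢ θ') (liftˢ θ x) ≡ liftˢ (λ y → sub θ' (θ y)) x
    lift-comm zero = refl
    lift-comm (suc x) = trans (sub-ren (liftˢ θ') suc (θ x)) (≡.sym (ren-sub suc θ' (θ x)))
  sub-sub θ θ' (app M N) = cong₂ app (sub-sub θ θ' M) (sub-sub θ θ' N)

  sub-var : ∀ {n n'} (ρ : Ren n n') M → sub (λ x → var (ρ x)) M ≡ ren ρ M
  sub-var ρ (var x) = refl
  sub-var ρ (lam M) =
    cong lam (trans (sub-cong (λ { zero → refl ; (suc x) → refl }) M) (sub-var (liftʳ ρ) M))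
  sub-var ρ (app M N) = cong₂ app (sub-var ρ M) (sub-var ρ N)

  ren-[] : ∀ {n n'} (ρ : Ren n n') B A → ren ρ (B [ A ]) ≡ ren (liftʳ ρ) B [ ren ρ A ]
  ren-[] ρ B A =
    trans (ren-sub ρ (A ∷ˢ var) B)
          (≡.sym (trans (sub-ren (ren ρ A ∷ˢ var) (liftʳ ρ) B) (sub-cong (λ { zero → refl ; (suc x) → refl }) B)))

  liftˢ-[] : ∀ {n n' n''} (θ : Sub n n') (ρ : Ren n' n'') B A →
             ren (liftʳ ρ) (sub (liftˢ θ) B) [ A ] ≡ sub (A ∷ˢ (λ x → ren ρ (θ x))) B
  liftˢ-[] θ ρ B A =
    trans (sub-ren (A ∷ˢ var) (liftʳ ρ) (sub (liftˢ θ) B))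
          (trans (sub-sub (liftˢ θ) _ B) (sub-cong instantiate B))
    where
    instantiate : ∀ x → sub (λ y → (A ∷ˢ var) (liftʳ ρ y)) (liftˢ θ x) ≡ (A ∷ˢ (λ y → ren ρ (θ y))) x
    instantiate zero = refl
    instantiate (suc x) = trans (sub-ren _ suc (θ x)) (sub-var ρ (θ x))

module Evaluation where
  open Substitution

  data Neutral : ∀ {n} → Term n → Set where
    var : ∀ {n} (x : Fin n) → Neutral (var x)
    app : ∀ {n} {W : Term n} A → Neutral W → Neutral (app W A)

  infix 4 _⇓ʷ_ _⇓_ _⇓ⁿᵉ_

  data _⇓ʷ_ : ∀ {n} → Term n → Term n → Set where
    ⇓ʷ-lam : ∀ {n} {B : Term (suc n)} → lam B ⇓ʷ lam B
    ⇓ʷ-var : ∀ {n} {x : Fin n} → var x ⇓ʷ var x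
    ⇓ʷ-β   : ∀ {n} {M A : Term n} {B W} → M ⇓ʷ lam B → B [ A ] ⇓ʷ W → app M A ⇓ʷ W
    ⇓ʷ-ne  : ∀ {n} {M A W : Term n} → M ⇓ʷ W → Neutral W → app M A ⇓ʷ app W A

  mutual
    data _⇓_ : ∀ {n} → Term n → Term n → Set where
      ⇓-lam : ∀ {n} {M : Term n} {B N} → M ⇓ʷ lam B → B ⇓ N → M ⇓ lam N
      ⇓-ne  : ∀ {n} {M W N : Term n} → M ⇓ʷ W → W ⇓ⁿᵉ N → M ⇓ N

    data _⇓ⁿᵉ_ : ∀ {n} → Term n → Term n → Set where
      ⇓ⁿᵉ-var : ∀ {n} {x : Fin n} → var x ⇓ⁿᵉ var x
      ⇓ⁿᵉ-app : ∀ {n} {W A N A' : Term n} → W ⇓ⁿᵉ N → A ⇓ A' → app W A ⇓ⁿᵉ app N A'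

  ⇓ʷ-det : ∀ {n} {M W W' : Term n} → M ⇓ʷ W → M ⇓ʷ W' → W ≡ W'
  ⇓ʷ-det ⇓ʷ-lam ⇓ʷ-lam = refl
  ⇓ʷ-det ⇓ʷ-var ⇓ʷ-var = refl
  ⇓ʷ-det (⇓ʷ-β p q) (⇓ʷ-β p' q') with ⇓ʷ-det p p'
  ... | refl = ⇓ʷ-det q q'
  ⇓ʷ-det (⇓ʷ-β p q) (⇓ʷ-ne p' w) with ⇓ʷ-det p p'
  ⇓ʷ-det (⇓ʷ-β p q) (⇓ʷ-ne p' ()) | refl
  ⇓ʷ-det (⇓ʷ-ne p w) (⇓ʷ-β p' q') with ⇓ʷ-det p p'
  ⇓ʷ-det (⇓ʷ-ne p ()) (⇓ʷ-β p' q') | refl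
  ⇓ʷ-det (⇓ʷ-ne p w) (⇓ʷ-ne p' w') with ⇓ʷ-det p p'
  ... | refl = refl

  mutual
    ⇓-det : ∀ {n} {M N N' : Term n} → M ⇓ N → M ⇓ N' → N ≡ N'
    ⇓-det (⇓-lam p q) (⇓-lam p' q') with ⇓ʷ-det p p'
    ... | refl = cong lam (⇓-det q q')
    ⇓-det (⇓-lam p q) (⇓-ne p' r) with ⇓ʷ-det p p'
    ⇓-det (⇓-lam p q) (⇓-ne p' ()) | refl
    ⇓-det (⇓-ne p r) (⇓-lam p' q) with ⇓ʷ-det p p'
    ⇓-det (⇓-ne p ()) (⇓-lam p' q) | refl
    ⇓-det (⇓-ne p r) (⇓-ne p' r') with ⇓ʷ-det p p'
    ... | refl = ⇓ⁿᵉ-det r r'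

    ⇓ⁿᵉ-det : ∀ {n} {M N N' : Term n} → M ⇓ⁿᵉ N → M ⇓ⁿᵉ N' → N ≡ N'
    ⇓ⁿᵉ-det ⇓ⁿᵉ-var ⇓ⁿᵉ-var = refl
    ⇓ⁿᵉ-det (⇓ⁿᵉ-app p q) (⇓ⁿᵉ-app p' q') = cong₂ app (⇓ⁿᵉ-det p p') (⇓-det q q')

  ren-neutral : ∀ {n n'} (ρ : Ren n n') {W} → Neutral W → Neutral (ren ρ W)
  ren-neutral ρ (var x) = var (ρ x)
  ren-neutral ρ (app A w) = app (ren ρ A) (ren-neutral ρ w)

  ren-⇓ʷ : ∀ {n n'} (ρ : Ren n n') {M W} → M ⇓ʷ W → ren ρ M ⇓ʷ ren ρ W
  ren-⇓ʷ ρ ⇓ʷ-lam = ⇓ʷ-lam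
  ren-⇓ʷ ρ ⇓ʷ-var = ⇓ʷ-var
  ren-⇓ʷ ρ (⇓ʷ-β {A = A} {B = B} p q) =
    ⇓ʷ-β (ren-⇓ʷ ρ p) (subst (_⇓ʷ _) (ren-[] ρ B A) (ren-⇓ʷ ρ q))
  ren-⇓ʷ ρ (⇓ʷ-ne p w) = ⇓ʷ-ne (ren-⇓ʷ ρ p) (ren-neutral ρ w)

  mutual
    ren-⇓ : ∀ {n n'} (ρ : Ren n n') {M N} → M ⇓ N → ren ρ M ⇓ ren ρ N
    ren-⇓ ρ (⇓-lam p q) = ⇓-lam (ren-⇓ʷ ρ p) (ren-⇓ (liftʳ ρ) q)
    ren-⇓ ρ (⇓-ne p q) = ⇓-ne (ren-⇓ʷ ρ p) (ren-⇓ⁿᵉ ρ q)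

    ren-⇓ⁿᵉ : ∀ {n n'} (ρ : Ren n n') {M N} → M ⇓ⁿᵉ N → ren ρ M ⇓ⁿᵉ ren ρ N
    ren-⇓ⁿᵉ ρ ⇓ⁿᵉ-var = ⇓ⁿᵉ-var
    ren-⇓ⁿᵉ ρ (⇓ⁿᵉ-app p q) = ⇓ⁿᵉ-app (ren-⇓ⁿᵉ ρ p) (ren-⇓ ρ q)

  infix 4 _⟶ₕ_
  data _⟶ₕ_ : ∀ {n} → Term n → Term n → Set where
    β   : ∀ {n} {B : Term (suc n)} {A} → app (lam B) A ⟶ₕ B [ A ]
    app : ∀ {n} {M M' C : Term n} → M ⟶ₕ M' → app M C ⟶ₕ app M' C

  ⟶ₕ-⇓ʷ : ∀ {n} {M M' W : Term n} → M ⟶ₕ M' → M' ⇓ʷ W → M ⇓ʷ W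
  ⟶ₕ-⇓ʷ β p = ⇓ʷ-β ⇓ʷ-lam p
  ⟶ₕ-⇓ʷ (app h) (⇓ʷ-β p q) = ⇓ʷ-β (⟶ₕ-⇓ʷ h p) q
  ⟶ₕ-⇓ʷ (app h) (⇓ʷ-ne p w) = ⇓ʷ-ne (⟶ₕ-⇓ʷ h p) w

  ⟶ₕ-⇓ : ∀ {n} {M M' N : Term n} → M ⟶ₕ M' → M' ⇓ N → M ⇓ N
  ⟶ₕ-⇓ h (⇓-lam p q) = ⇓-lam (⟶ₕ-⇓ʷ h p) q
  ⟶ₕ-⇓ h (⇓-ne p q) = ⇓-ne (⟶ₕ-⇓ʷ h p) q

  ren-⟶ₕ : ∀ {n n'} (ρ : Ren n n') {M M'} → M ⟶ₕ M' → ren ρ M ⟶ₕ ren ρ M'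
  ren-⟶ₕ ρ (β {B = B} {A = A}) = subst (app (ren ρ (lam B)) (ren ρ A) ⟶ₕ_) (≡.sym (ren-[] ρ B A)) β
  ren-⟶ₕ ρ (app h) = app (ren-⟶ₕ ρ h)

module Subtyping {m : ℕ} where

  infix 4 _≲_ _∋∩_ _≃_

  -- σ ≲ τ : every conjunct of τ is, up to ≃ on arrows, a conjunct of σ (σ ∋∩ c).
  -- It contains ≈ (≈⇒≃) and, unlike ≈, can be inverted by pattern matching.
  mutual
    _≲_ : Ty m → Ty m → Set
    σ ≲ τ₁ ∩ τ₂ = σ ≲ τ₁ × σ ≲ τ₂
    σ ≲ at α = σ ∋∩ at α
    σ ≲ τ₁ ⇒ τ₂ = σ ∋∩ τ₁ ⇒ τ₂

    _∋∩_ : Ty m → Ty m → Set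
    σ₁ ∩ σ₂ ∋∩ c = σ₁ ∋∩ c ⊎ σ₂ ∋∩ c
    at β ∋∩ at α = β ≡ α
    a' ⇒ b' ∋∩ a ⇒ b = a' ≃ a × b' ≃ b
    at β ∋∩ _ ⇒ _ = ⊥
    at β ∋∩ _ ∩ _ = ⊥
    _ ⇒ _ ∋∩ at _ = ⊥
    _ ⇒ _ ∋∩ _ ∩ _ = ⊥

    record _≃_ (σ τ : Ty m) : Set where
      inductive
      pattern
      constructor _,,_
      field
        ≲-to   : σ ≲ τ
        ≲-from : τ ≲ σ
  open _≃_ public

  ≲-∩ˡ : ∀ {σ τ} ρ → σ ≲ ρ → σ ∩ τ ≲ ρ
  ≲-∩ˡ (ρ₁ ∩ ρ₂) (p , q) = ≲-∩ˡ ρ₁ p , ≲-∩ˡ ρ₂ q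
  ≲-∩ˡ (at α) p = inj₁ p
  ≲-∩ˡ (ρ₁ ⇒ ρ₂) p = inj₁ p

  ≲-∩ʳ : ∀ {σ τ} ρ → τ ≲ ρ → σ ∩ τ ≲ ρ
  ≲-∩ʳ (ρ₁ ∩ ρ₂) (p , q) = ≲-∩ʳ ρ₁ p , ≲-∩ʳ ρ₂ q
  ≲-∩ʳ (at α) p = inj₂ p
  ≲-∩ʳ (ρ₁ ⇒ ρ₂) p = inj₂ p

  mutual
    ≲-refl : ∀ σ → σ ≲ σ
    ≲-refl (σ ∩ τ) = ≲-∩ˡ σ (≲-refl σ) , ≲-∩ʳ τ (≲-refl τ)
    ≲-refl (at α) = refl
    ≲-refl (σ ⇒ τ) = ≃-refl σ , ≃-refl τ

    ≃-refl : ∀ σ → σ ≃ σ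
    ≃-refl σ = ≲-refl σ ,, ≲-refl σ

  ∋∩-⇒-refl : ∀ σ τ → σ ⇒ τ ∋∩ σ ⇒ τ
  ∋∩-⇒-refl σ τ = ≲-refl (σ ⇒ τ)

  mutual
    ≲-trans : ∀ σ τ ρ → σ ≲ τ → τ ≲ ρ → σ ≲ ρ
    ≲-trans σ τ (ρ₁ ∩ ρ₂) p (q₁ , q₂) = ≲-trans σ τ ρ₁ p q₁ , ≲-trans σ τ ρ₂ p q₂
    ≲-trans σ τ (at α) p q = ≲-∋∩ σ τ (at α) p q
    ≲-trans σ τ (ρ₁ ⇒ ρ₂) p q = ≲-∋∩ σ τ (ρ₁ ⇒ ρ₂) p q

    ≲-∋∩ : ∀ σ τ c → σ ≲ τ → τ ∋∩ c → σ ∋∩ c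
    ≲-∋∩ σ (τ₁ ∩ τ₂) c (p₁ , p₂) (inj₁ q) = ≲-∋∩ σ τ₁ c p₁ q
    ≲-∋∩ σ (τ₁ ∩ τ₂) c (p₁ , p₂) (inj₂ q) = ≲-∋∩ σ τ₂ c p₂ q
    ≲-∋∩ σ (at β) (at α) p refl = p
    ≲-∋∩ σ (a' ⇒ b') (a ⇒ b) p q = ∋∩-⇒-trans σ a' b' a b p q

    ∋∩-⇒-trans : ∀ σ a' b' a b → σ ∋∩ a' ⇒ b' → a' ⇒ b' ∋∩ a ⇒ b → σ ∋∩ a ⇒ b
    ∋∩-⇒-trans (σ₁ ∩ σ₂) a' b' a b (inj₁ p) q = inj₁ (∋∩-⇒-trans σ₁ a' b' a b p q)
    ∋∩-⇒-trans (σ₁ ∩ σ₂) a' b' a b (inj₂ p) q = inj₂ (∋∩-⇒-trans σ₂ a' b' a b p q)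
    ∋∩-⇒-trans (a'' ⇒ b'') a' b' a b (p , q) (p' , q') = ≃-trans p p' , ≃-trans q q'

    ≃-trans : ∀ {σ τ ρ} → σ ≃ τ → τ ≃ ρ → σ ≃ ρ
    ≃-trans {σ} {τ} {ρ} (p ,, q) (p' ,, q') = ≲-trans σ τ ρ p p' ,, ≲-trans ρ τ σ q' q

  ≃-sym : ∀ {σ τ} → σ ≃ τ → τ ≃ σ
  ≃-sym (p ,, q) = q ,, p

  ⇒-≃ : ∀ {σ σ' τ τ'} → σ ≃ σ' → τ ≃ τ' → σ ⇒ τ ≃ σ' ⇒ τ'
  ⇒-≃ p q = (p , q) ,, (≃-sym p , ≃-sym q)

  ∩-≃ : ∀ {σ σ' τ τ'} → σ ≃ σ' → τ ≃ τ' → σ ∩ τ ≃ σ' ∩ τ'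
  ∩-≃ {σ} {σ'} {τ} {τ'} (p ,, p') (q ,, q') = (≲-∩ˡ σ' p , ≲-∩ʳ τ' q) ,, (≲-∩ˡ σ p' , ≲-∩ʳ τ q')

  ≈⇒≃ : ∀ {σ τ} → σ ≈ τ → σ ≃ τ
  ≈⇒≃ {σ} ≈-refl = ≃-refl σ
  ≈⇒≃ (≈-sym p) = ≃-sym (≈⇒≃ p)
  ≈⇒≃ (≈-trans p q) = ≃-trans (≈⇒≃ p) (≈⇒≃ q)
  ≈⇒≃ (⇒-cong p q) = ⇒-≃ (≈⇒≃ p) (≈⇒≃ q)
  ≈⇒≃ (∩-cong p q) = ∩-≃ (≈⇒≃ p) (≈⇒≃ q)
  ≈⇒≃ (∩-idem {σ}) = ≲-∩ˡ σ (≲-refl σ) ,, (≲-refl σ , ≲-refl σ)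
  ≈⇒≃ (∩-comm {σ} {τ}) = (≲-∩ʳ τ (≲-refl τ) , ≲-∩ˡ σ (≲-refl σ)) ,,
                          (≲-∩ʳ σ (≲-refl σ) , ≲-∩ˡ τ (≲-refl τ))
  ≈⇒≃ (∩-assoc {σ} {τ} {ρ}) =
    (≲-∩ˡ σ (≲-∩ˡ σ (≲-refl σ)) , (≲-∩ˡ τ (≲-∩ʳ τ (≲-refl τ)) , ≲-∩ʳ ρ (≲-refl ρ))) ,,
    ((≲-∩ˡ σ (≲-refl σ) , ≲-∩ʳ τ (≲-∩ˡ τ (≲-refl τ))) , ≲-∩ʳ ρ (≲-∩ʳ ρ (≲-refl ρ)))

module Normalisation {m : ℕ} where
  open Substitution
  open Evaluation
  open Subtyping {m}

  infix 3 _⊢ⁿᶠ_∶_ _⊢ⁿᵉ_∶_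
  mutual
    data _⊢ⁿᶠ_∶_ {n : ℕ} (Γ : Ctx m n) : Term n → Ty m → Set where
      nf-lam : ∀ {B σ τ} → (σ ∷ Γ) ⊢ⁿᶠ B ∶ τ → Γ ⊢ⁿᶠ lam B ∶ σ ⇒ τ
      nf-ne  : ∀ {N σ} → Γ ⊢ⁿᵉ N ∶ σ → Γ ⊢ⁿᶠ N ∶ σ
      nf-∩   : ∀ {N σ τ} → Γ ⊢ⁿᶠ N ∶ σ → Γ ⊢ⁿᶠ N ∶ τ → Γ ⊢ⁿᶠ N ∶ σ ∩ τ
      nf-≃   : ∀ {N σ τ} → Γ ⊢ⁿᶠ N ∶ σ → σ ≃ τ → Γ ⊢ⁿᶠ N ∶ τ

    data _⊢ⁿᵉ_∶_ {n : ℕ} (Γ : Ctx m n) : Term n → Ty m → Set where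
      ne-var : ∀ x → Γ ⊢ⁿᵉ var x ∶ lookup Γ x
      ne-app : ∀ {M N σ τ} → Γ ⊢ⁿᵉ M ∶ σ ⇒ τ → Γ ⊢ⁿᶠ N ∶ σ → Γ ⊢ⁿᵉ app M N ∶ τ
      ne-∩ˡ  : ∀ {M σ τ} → Γ ⊢ⁿᵉ M ∶ σ ∩ τ → Γ ⊢ⁿᵉ M ∶ σ
      ne-∩ʳ  : ∀ {M σ τ} → Γ ⊢ⁿᵉ M ∶ σ ∩ τ → Γ ⊢ⁿᵉ M ∶ τ
      ne-≃   : ∀ {M σ τ} → Γ ⊢ⁿᵉ M ∶ σ → σ ≃ τ → Γ ⊢ⁿᵉ M ∶ τ

  infix 4 _∶_⇒ʳ_
  _∶_⇒ʳ_ : ∀ {n n'} → Ren n n' → Ctx m n → Ctx m n' → Set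
  ρ ∶ Γ ⇒ʳ Δ = ∀ x → lookup Δ (ρ x) ≡ lookup Γ x

  liftʳ-⇒ʳ : ∀ {n n'} {ρ : Ren n n'} {Γ Δ} σ → ρ ∶ Γ ⇒ʳ Δ → liftʳ ρ ∶ σ ∷ Γ ⇒ʳ σ ∷ Δ
  liftʳ-⇒ʳ σ ok zero = refl
  liftʳ-⇒ʳ σ ok (suc x) = ok x

  mutual
    ren-⊢ⁿᶠ : ∀ {n n'} {ρ : Ren n n'} {Γ Δ N σ} → ρ ∶ Γ ⇒ʳ Δ → Γ ⊢ⁿᶠ N ∶ σ → Δ ⊢ⁿᶠ ren ρ N ∶ σ
    ren-⊢ⁿᶠ ok (nf-lam {σ = σ} d) = nf-lam (ren-⊢ⁿᶠ (liftʳ-⇒ʳ σ ok) d)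
    ren-⊢ⁿᶠ ok (nf-ne d) = nf-ne (ren-⊢ⁿᵉ ok d)
    ren-⊢ⁿᶠ ok (nf-∩ d e) = nf-∩ (ren-⊢ⁿᶠ ok d) (ren-⊢ⁿᶠ ok e)
    ren-⊢ⁿᶠ ok (nf-≃ d e) = nf-≃ (ren-⊢ⁿᶠ ok d) e

    ren-⊢ⁿᵉ : ∀ {n n'} {ρ : Ren n n'} {Γ Δ N σ} → ρ ∶ Γ ⇒ʳ Δ → Γ ⊢ⁿᵉ N ∶ σ → Δ ⊢ⁿᵉ ren ρ N ∶ σ
    ren-⊢ⁿᵉ {ρ = ρ} {Δ = Δ} ok (ne-var x) = subst (Δ ⊢ⁿᵉ var (ρ x) ∶_) (ok x) (ne-var (ρ x))
    ren-⊢ⁿᵉ ok (ne-app d e) = ne-app (ren-⊢ⁿᵉ ok d) (ren-⊢ⁿᶠ ok e)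
    ren-⊢ⁿᵉ ok (ne-∩ˡ d) = ne-∩ˡ (ren-⊢ⁿᵉ ok d)
    ren-⊢ⁿᵉ ok (ne-∩ʳ d) = ne-∩ʳ (ren-⊢ⁿᵉ ok d)
    ren-⊢ⁿᵉ ok (ne-≃ d e) = ne-≃ (ren-⊢ⁿᵉ ok d) e

  HasNf : ∀ {n} → Ctx m n → Ty m → Term n → Set
  HasNf Γ σ M = ∃ λ N → M ⇓ N × Γ ⊢ⁿᶠ N ∶ σ

  Red : ∀ {n} → Ctx m n → Ty m → Term n → Set
  Red Γ (at α) M = HasNf Γ (at α) M
  Red {n} Γ (σ ⇒ τ) M = HasNf Γ (σ ⇒ τ) M ×
    (∀ {n'} (Δ : Ctx m n') (ρ : Ren n n') → ρ ∶ Γ ⇒ʳ Δ → ∀ A → Red Δ σ A → Red Δ τ (app (ren ρ M) A))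
  Red Γ (σ ∩ τ) M = Red Γ σ M × Red Γ τ M

  reify : ∀ {n} {Γ : Ctx m n} σ {M} → Red Γ σ M → HasNf Γ σ M
  reify (at α) r = r
  reify (σ ⇒ τ) r = proj₁ r
  reify (σ ∩ τ) (r₁ , r₂) with reify σ r₁ | reify τ r₂
  ... | N , p , d | N' , p' , d' with ⇓-det p p'
  ... | refl = N , p , nf-∩ d d'

  reflect : ∀ {n} {Γ : Ctx m n} σ {M W N} → M ⇓ʷ W → Neutral W → W ⇓ⁿᵉ N → Γ ⊢ⁿᵉ N ∶ σ → Red Γ σ M
  reflect (at α) p w q d = _ , ⇓-ne p q , nf-ne d
  reflect (σ ⇒ τ) p w q d =
    (_ , ⇓-ne p q , nf-ne d) ,
    λ Δ ρ ok A r → let (A' , pa , da) = reify σ r in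
      reflect τ (⇓ʷ-ne (ren-⇓ʷ ρ p) (ren-neutral ρ w)) (app A (ren-neutral ρ w))
        (⇓ⁿᵉ-app (ren-⇓ⁿᵉ ρ q) pa) (ne-app (ren-⊢ⁿᵉ ok d) da)
  reflect (σ ∩ τ) p w q d = reflect σ p w q (ne-∩ˡ d) , reflect τ p w q (ne-∩ʳ d)

  red-var : ∀ {n} {Γ : Ctx m n} x → Red Γ (lookup Γ x) (var x)
  red-var {Γ = Γ} x = reflect (lookup Γ x) ⇓ʷ-var (var x) ⇓ⁿᵉ-var (ne-var x)

  red-ren : ∀ {n n'} {Γ : Ctx m n} {Δ : Ctx m n'} σ {M} (ρ : Ren n n') → ρ ∶ Γ ⇒ʳ Δ →
            Red Γ σ M → Red Δ σ (ren ρ M)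
  red-ren (at α) ρ ok (N , p , d) = ren ρ N , ren-⇓ ρ p , ren-⊢ⁿᶠ ok d
  red-ren (σ ⇒ τ) {M} ρ ok ((N , p , d) , f) =
    (ren ρ N , ren-⇓ ρ p , ren-⊢ⁿᶠ ok d) ,
    λ Δ' ρ' ok' A r → subst (λ t → Red Δ' τ (app t A)) (≡.sym (ren-ren ρ ρ' M))
      (f Δ' (λ x → ρ' (ρ x)) (λ x → trans (ok' (ρ x)) (ok x)) A r)
  red-ren (σ ∩ τ) ρ ok (r₁ , r₂) = red-ren σ ρ ok r₁ , red-ren τ ρ ok r₂

  red-⟶ₕ : ∀ {n} {Γ : Ctx m n} σ {M M'} → M ⟶ₕ M' → Red Γ σ M' → Red Γ σ M
  red-⟶ₕ (at α) h (N , p , d) = N , ⟶ₕ-⇓ h p , d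
  red-⟶ₕ (σ ⇒ τ) h ((N , p , d) , f) =
    (N , ⟶ₕ-⇓ h p , d) , λ Δ ρ ok A r → red-⟶ₕ τ (app (ren-⟶ₕ ρ h)) (f Δ ρ ok A r)
  red-⟶ₕ (σ ∩ τ) h (r₁ , r₂) = red-⟶ₕ σ h r₁ , red-⟶ₕ τ h r₂

  red-≈ : ∀ {σ τ} → σ ≈ τ →
          (∀ {n} {Γ : Ctx m n} {M} → Red Γ σ M → Red Γ τ M) ×
          (∀ {n} {Γ : Ctx m n} {M} → Red Γ τ M → Red Γ σ M)
  red-≈ ≈-refl = (λ r → r) , (λ r → r)
  red-≈ (≈-sym p) = proj₂ (red-≈ p) , proj₁ (red-≈ p)
  red-≈ (≈-trans p q) = (λ r → proj₁ (red-≈ q) (proj₁ (red-≈ p) r)) ,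
                        (λ r → proj₂ (red-≈ p) (proj₂ (red-≈ q) r))
  red-≈ (⇒-cong p q) =
    (λ { ((N , r , d) , f) → (N , r , nf-≃ d (≈⇒≃ (⇒-cong p q))) ,
          λ Δ ρ ok A a → proj₁ (red-≈ q) (f Δ ρ ok A (proj₂ (red-≈ p) a)) }) ,
    (λ { ((N , r , d) , f) → (N , r , nf-≃ d (≈⇒≃ (≈-sym (⇒-cong p q)))) ,
          λ Δ ρ ok A a → proj₂ (red-≈ q) (f Δ ρ ok A (proj₁ (red-≈ p) a)) })
  red-≈ (∩-cong p q) = (λ { (a , b) → proj₁ (red-≈ p) a , proj₁ (red-≈ q) b }) ,
                       (λ { (a , b) → proj₂ (red-≈ p) a , proj₂ (red-≈ q) b })
  red-≈ ∩-idem = proj₁ , (λ r → r , r)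
  red-≈ ∩-comm = (λ { (a , b) → b , a }) , (λ { (a , b) → b , a })
  red-≈ ∩-assoc = (λ { ((a , b) , c) → a , (b , c) }) , (λ { (a , (b , c)) → (a , b) , c })

  RedSub : ∀ {n n'} → Ctx m n' → Ctx m n → Sub n n' → Set
  RedSub Δ Γ θ = ∀ x → Red Δ (lookup Γ x) (θ x)

  fundamental : ∀ {n n'} {Γ : Ctx m n} {Δ : Ctx m n'} {M σ} → Γ ⊢ M ∶ σ → (θ : Sub n n') →
                RedSub Δ Γ θ → Red Δ σ (sub θ M)
  fundamental (ax x) θ rs = rs x
  fundamental {Δ = Δ} (→I {M = B} {σ = σ} {τ = τ} d) θ rs =
    (let (N , p , dn) = reify τ (fundamental d (liftˢ θ) rs-lift) in lam N , ⇓-lam ⇓ʷ-lam p , nf-lam dn) ,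
    λ Δ' ρ ok A a →
      red-⟶ₕ τ β (subst (Red Δ' τ) (≡.sym (liftˢ-[] θ ρ B A))
                   (fundamental d (A ∷ˢ (λ x → ren ρ (θ x))) (rs-cons ρ ok a)))
    where
    rs-lift : RedSub (σ ∷ Δ) (σ ∷ _) (liftˢ θ)
    rs-lift zero = red-var zero
    rs-lift (suc x) = red-ren _ suc (λ _ → refl) (rs x)
    rs-cons : ∀ {n''} {Δ' : Ctx m n''} {A} (ρ : Ren _ n'') → ρ ∶ Δ ⇒ʳ Δ' → Red Δ' σ A →
              RedSub Δ' (σ ∷ _) (A ∷ˢ (λ x → ren ρ (θ x)))
    rs-cons ρ ok a zero = a
    rs-cons ρ ok a (suc x) = red-ren _ ρ ok (rs x)
  fundamental {Δ = Δ} (→E {M = M} {N = N} d e) θ rs =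
    subst (λ t → Red Δ _ (app t (sub θ N))) (ren-id (sub θ M))
      (proj₂ (fundamental d θ rs) Δ (λ x → x) (λ x → refl) (sub θ N) (fundamental e θ rs))
  fundamental (∩I d e) θ rs = fundamental d θ rs , fundamental e θ rs
  fundamental (∩E d) θ rs = proj₁ (fundamental d θ rs)
  fundamental (conv d p) θ rs = proj₁ (red-≈ p) (fundamental d θ rs)

  normalise : ∀ {M : Term 0} {σ} → [] ⊢ M ∶ σ → ∃ λ N → [] ⊢ⁿᶠ N ∶ σ
  normalise {σ = σ} d = let (N , _ , dn) = reify σ (fundamental d (λ ()) (λ ())) in N , dn

module Inversion {m : ℕ} where
  open Subtyping {m}
  open Normalisation {m}

  data NfView {n} (Γ : Ctx m n) : Term n → Ty m → Set where
    view-lam : ∀ {B σ ρ} → (σ ∷ Γ) ⊢ⁿᶠ B ∶ ρ → NfView Γ (lam B) (σ ⇒ ρ)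
    view-ne  : ∀ {N c} → Γ ⊢ⁿᵉ N ∶ c → NfView Γ N c

  data NeView {n} (Γ : Ctx m n) : Term n → Ty m → Set where
    view-var : ∀ {x c} → lookup Γ x ∋∩ c → NeView Γ (var x) c
    view-app : ∀ {M A σ ρ c} → Γ ⊢ⁿᵉ M ∶ σ ⇒ ρ → Γ ⊢ⁿᶠ A ∶ σ → ρ ∋∩ c → NeView Γ (app M A) c

  ne-∋∩ : ∀ {n} {Γ : Ctx m n} {N} τ c → Γ ⊢ⁿᵉ N ∶ τ → τ ∋∩ c → Γ ⊢ⁿᵉ N ∶ c
  ne-∋∩ (τ₁ ∩ τ₂) c d (inj₁ q) = ne-∋∩ τ₁ c (ne-∩ˡ d) q
  ne-∋∩ (τ₁ ∩ τ₂) c d (inj₂ q) = ne-∋∩ τ₂ c (ne-∩ʳ d) q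
  ne-∋∩ (at β) (at α) d refl = d
  ne-∋∩ (a' ⇒ b') (a ⇒ b) d (p , q) = ne-≃ d (⇒-≃ p q)

  infix 4 _≃ᶜ_
  _≃ᶜ_ : ∀ {n} → Ctx m n → Ctx m n → Set
  Γ ≃ᶜ Γ' = ∀ x → lookup Γ' x ≃ lookup Γ x

  mutual
    nf-≃ᶜ : ∀ {n} {Γ Γ' : Ctx m n} {N σ} → Γ ≃ᶜ Γ' → Γ ⊢ⁿᶠ N ∶ σ → Γ' ⊢ⁿᶠ N ∶ σ
    nf-≃ᶜ ce (nf-lam {σ = σ} d) = nf-lam (nf-≃ᶜ (λ { zero → ≃-refl σ ; (suc x) → ce x }) d)
    nf-≃ᶜ ce (nf-ne d) = nf-ne (ne-≃ᶜ ce d)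
    nf-≃ᶜ ce (nf-∩ d e) = nf-∩ (nf-≃ᶜ ce d) (nf-≃ᶜ ce e)
    nf-≃ᶜ ce (nf-≃ d e) = nf-≃ (nf-≃ᶜ ce d) e

    ne-≃ᶜ : ∀ {n} {Γ Γ' : Ctx m n} {N σ} → Γ ≃ᶜ Γ' → Γ ⊢ⁿᵉ N ∶ σ → Γ' ⊢ⁿᵉ N ∶ σ
    ne-≃ᶜ ce (ne-var x) = ne-≃ (ne-var x) (ce x)
    ne-≃ᶜ ce (ne-app d e) = ne-app (ne-≃ᶜ ce d) (nf-≃ᶜ ce e)
    ne-≃ᶜ ce (ne-∩ˡ d) = ne-∩ˡ (ne-≃ᶜ ce d)
    ne-≃ᶜ ce (ne-∩ʳ d) = ne-∩ʳ (ne-≃ᶜ ce d)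
    ne-≃ᶜ ce (ne-≃ d e) = ne-≃ (ne-≃ᶜ ce d) e

  nf-view : ∀ {n} {Γ : Ctx m n} {N τ} c → Γ ⊢ⁿᶠ N ∶ τ → τ ∋∩ c → NfView Γ N c
  nf-view (σ ⇒ ρ) (nf-lam d) (p , q) =
    view-lam (nf-≃ (nf-≃ᶜ (λ { zero → ≃-sym p ; (suc x) → ≃-refl _ }) d) q)
  nf-view (at _) (nf-lam d) ()
  nf-view (_ ∩ _) (nf-lam d) ()
  nf-view {τ = τ} c (nf-ne d) q = view-ne (ne-∋∩ τ c d q)
  nf-view c (nf-∩ d e) (inj₁ q) = nf-view c d q
  nf-view c (nf-∩ d e) (inj₂ q) = nf-view c e q
  nf-view {τ = τ} c (nf-≃ {σ = σ} d e) q = nf-view c d (≲-∋∩ σ τ c (≲-to e) q)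

  ne-view : ∀ {n} {Γ : Ctx m n} {N τ} c → Γ ⊢ⁿᵉ N ∶ τ → τ ∋∩ c → NeView Γ N c
  ne-view c (ne-var x) q = view-var q
  ne-view c (ne-app d e) q = view-app d e q
  ne-view c (ne-∩ˡ d) q = ne-view c d (inj₁ q)
  ne-view c (ne-∩ʳ d) q = ne-view c d (inj₂ q)
  ne-view {τ = τ} c (ne-≃ {σ = σ} d e) q = ne-view c d (≲-∋∩ σ τ c (≲-to e) q)

  ne-view-⇒ : ∀ {n} {Γ : Ctx m n} {N σ ρ} → Γ ⊢ⁿᵉ N ∶ σ ⇒ ρ → NeView Γ N (σ ⇒ ρ)
  ne-view-⇒ {σ = σ} {ρ} d = ne-view (σ ⇒ ρ) d (∋∩-⇒-refl σ ρ)

  arity : Ty m → ℕ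
  arity (at _) = 0
  arity (σ ⇒ τ) = suc (arity τ)
  arity (σ ∩ τ) = arity σ ⊔ arity τ

  mutual
    arity-≲ : ∀ σ τ → σ ≲ τ → arity τ ≤ arity σ
    arity-≲ σ (τ₁ ∩ τ₂) (p , q) = ⊔-lub (arity-≲ σ τ₁ p) (arity-≲ σ τ₂ q)
    arity-≲ σ (at α) p = z≤n
    arity-≲ σ (τ₁ ⇒ τ₂) p = arity-∋∩ σ (τ₁ ⇒ τ₂) p

    arity-∋∩ : ∀ σ c → σ ∋∩ c → arity c ≤ arity σ
    arity-∋∩ (σ₁ ∩ σ₂) c (inj₁ p) = ≤-trans (arity-∋∩ σ₁ c p) (m≤m⊔n (arity σ₁) (arity σ₂))
    arity-∋∩ (σ₁ ∩ σ₂) c (inj₂ p) = ≤-trans (arity-∋∩ σ₂ c p) (m≤n⊔m (arity σ₁) (arity σ₂))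
    arity-∋∩ (at β) (at α) p = z≤n
    arity-∋∩ (a' ⇒ b') (a ⇒ b) (_ , q) = s≤s (arity-≲ b' b (≲-to q))

  spine : ∀ {n} → Term n → ℕ
  spine (app M _) = suc (spine M)
  spine _ = 0

  headArity : ∀ {n} → Ctx m n → Term n → ℕ
  headArity Γ (var x) = arity (lookup Γ x)
  headArity Γ (app M _) = headArity Γ M
  headArity Γ (lam _) = 0

  arity+spine≤headArity : ∀ {n} {Γ : Ctx m n} (M : Term n) {τ} c → Γ ⊢ⁿᵉ M ∶ τ → τ ∋∩ c →
                          arity c + spine M ≤ headArity Γ M
  arity+spine≤headArity M c d q with ne-view c d q
  arity+spine≤headArity {Γ = Γ} (var x) c d q | view-var q' =
    subst (_≤ arity (lookup Γ x)) (≡.sym (+-identityʳ (arity c))) (arity-∋∩ (lookup Γ x) c q')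
  arity+spine≤headArity {Γ = Γ} (app M A) c d q | view-app {σ = σ} {ρ = ρ} dM dA q' =
    subst (_≤ headArity Γ M) (≡.sym (+-suc (arity c) (spine M)))
      (≤-trans (s≤s (+-monoˡ-≤ (spine M) (arity-∋∩ ρ c q')))
               (arity+spine≤headArity M (σ ⇒ ρ) dM (∋∩-⇒-refl σ ρ)))

  ⋂-∋∩ : ∀ k (f : Fin (suc k) → Ty m) c → ⋂ k f ∋∩ c → ∃ λ e → f e ∋∩ c
  ⋂-∋∩ zero f c q = zero , q
  ⋂-∋∩ (suc k) f c (inj₁ q) = zero , q
  ⋂-∋∩ (suc k) f c (inj₂ q) with ⋂-∋∩ k (λ e → f (suc e)) c q
  ... | e , q' = suc e , q'

  arity-⋂ : ∀ k (f : Fin (suc k) → Ty m) b → (∀ e → arity (f e) ≤ b) → arity (⋂ k f) ≤ b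
  arity-⋂ zero f b h = h zero
  arity-⋂ (suc k) f b h = ⊔-lub (h zero) (arity-⋂ k (λ e → f (suc e)) b (λ e → h (suc e)))

  headArity-≤ : ∀ {n} {Γ : Ctx m n} {k} → (∀ x → arity (lookup Γ x) ≤ k) → ∀ M → headArity Γ M ≤ k
  headArity-≤ bound (var x) = bound x
  headArity-≤ bound (app M _) = headArity-≤ bound M
  headArity-≤ bound (lam _) = z≤n

  data SpineView {n} (Γ : Ctx m n) : Term n → Ty m → Set where
    head₀ : ∀ {x c} → lookup Γ x ∋∩ c → SpineView Γ (var x) c
    head₁ : ∀ {x A σ ρ c} → lookup Γ x ∋∩ σ ⇒ ρ → Γ ⊢ⁿᶠ A ∶ σ → ρ ∋∩ c → SpineView Γ (app (var x) A) c
    head₂ : ∀ {x A B σ' ρ' σ ρ c} → lookup Γ x ∋∩ σ' ⇒ ρ' → Γ ⊢ⁿᶠ A ∶ σ' → ρ' ∋∩ σ ⇒ ρ →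
            Γ ⊢ⁿᶠ B ∶ σ → ρ ∋∩ c → SpineView Γ (app (app (var x) A) B) c

  spine-view : ∀ {n} {Γ : Ctx m n} → (∀ x → arity (lookup Γ x) ≤ 2) →
               ∀ {N τ} c → Γ ⊢ⁿᵉ N ∶ τ → τ ∋∩ c → SpineView Γ N c
  spine-view bound c d q with ne-view c d q
  ... | view-var q₀ = head₀ q₀
  ... | view-app dM dA q₁ with ne-view-⇒ dM
  ...   | view-var q₀ = head₁ q₀ dA q₁
  ...   | view-app dM' dA' q₂ with ne-view-⇒ dM'
  ...     | view-var q₀ = head₂ q₀ dA' q₂ dA q₁
  ...     | view-app {M = M} _ _ _ =
    -- a third argument would need a head of arity at least 3
    ⊥-elim (too-deep _ _ (arity-∋∩ _ _ q₂)
             (≤-trans (arity+spine≤headArity _ _ dM' (∋∩-⇒-refl _ _)) (headArity-≤ bound M)))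
    where
    too-deep : ∀ a s {k} → suc k ≤ a → suc a + suc s ≤ 2 → ⊥
    too-deep (suc zero) s _ (s≤s (s≤s ()))
    too-deep (suc (suc a)) s _ (s≤s (s≤s ()))

module HeadAnalysis {m : ℕ} (s0 s1 : Sym m) (R : List (Rule m)) where
  open Encoding s0 s1
  open Subtyping {m}
  open Normalisation {m}
  open Inversion {m}

  data Marker : Atom m → Set where
    marker-l : Marker atl
    marker-r : Marker atr
    marker-• : Marker bullet

  data Assumption : Ty m → Set where
    asm-σ0   : Assumption σ0
    asm-σ*   : Assumption σ*
    asm-σ1   : Assumption σ1
    asm-rule : ∀ {a b c d} → (a , b , c , d) ∈ R → Assumption (σRule (a , b , c , d))

  data Admissible : Ty m → Set where
    assumption : ∀ {T} → Assumption T → Admissible T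
    marker     : ∀ {β} → Marker β → Admissible (at β)

  Assumptions : ∀ {n} → Ctx m n → Set
  Assumptions Γ = ∀ k → Assumption (lookup Γ k)

  assumptions-∷ : ∀ {n T} {Γ : Ctx m n} → Assumption T → Assumptions Γ → Assumptions (T ∷ Γ)
  assumptions-∷ asmT asm zero = asmT
  assumptions-∷ asmT asm (suc k) = asm k

  assumptions⇒admissible : ∀ {n} {Γ : Ctx m n} → Assumptions Γ → ∀ x → Admissible (lookup Γ x)
  assumptions⇒admissible asm x = assumption (asm x)

  sym-injective : ∀ {a b : Sym m} → Atom.sym a ≡ sym b → a ≡ b
  sym-injective refl = refl

  assumption-not-marker : ∀ {T β} → Assumption T → Marker β → T ≢ at β
  assumption-not-marker asm-σ1 marker-l ()
  assumption-not-marker asm-σ1 marker-r ()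
  assumption-not-marker asm-σ1 marker-• ()

  arity-admissible : ∀ {T} → Admissible T → arity T ≤ 2
  arity-admissible (assumption asm-σ0) = s≤s z≤n
  arity-admissible (assumption asm-σ*) = s≤s z≤n
  arity-admissible (assumption asm-σ1) = z≤n
  arity-admissible (assumption (asm-rule _)) =
    ⊔-lub (s≤s (s≤s z≤n)) (⊔-lub (s≤s (s≤s z≤n)) (arity-⋂ m _ 2 (λ _ → s≤s (s≤s z≤n))))
  arity-admissible (marker _) = z≤n

  data AtomOf : Ty m → Atom m → Set where
    σ1-atom     : AtomOf σ1 (sym s1)
    marker-atom : ∀ {β} → Marker β → AtomOf (at β) β

  atom-of : ∀ {T g} → Admissible T → T ∋∩ at g → AtomOf T g
  atom-of (assumption asm-σ0) (inj₁ ())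
  atom-of (assumption asm-σ0) (inj₂ (inj₁ ()))
  atom-of (assumption asm-σ0) (inj₂ (inj₂ ()))
  atom-of (assumption asm-σ*) (inj₁ ())
  atom-of (assumption asm-σ*) (inj₂ (inj₁ ()))
  atom-of (assumption asm-σ*) (inj₂ (inj₂ ()))
  atom-of (assumption asm-σ1) refl = σ1-atom
  atom-of (assumption (asm-rule _)) (inj₁ ())
  atom-of (assumption (asm-rule _)) (inj₂ (inj₁ ()))
  atom-of (assumption (asm-rule _)) (inj₂ (inj₂ q)) with ⋂-∋∩ m _ _ q
  ... | _ , ()
  atom-of (marker mk) refl = marker-atom mk

  data ArrowOf : Ty m → Ty m → Ty m → Set where
    σ0-•   : ArrowOf σ0 (• ⇒ ⟨ s0 ⟩) *
    σ0-l   : ArrowOf σ0 (l ⇒ ⟨ s0 ⟩) #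
    σ0-r   : ArrowOf σ0 (r ⇒ ⟨ s0 ⟩) $
    σ*-•   : ArrowOf σ* (• ⇒ *) *
    σ*-l   : ArrowOf σ* (l ⇒ *) #
    σ*-r•  : ArrowOf σ* ((r ⇒ #) ∩ (• ⇒ $)) $
    rule-l : ∀ {a b c d} → (a , b , c , d) ∈ R → ArrowOf (σRule (a , b , c , d)) l (⟨ c ⟩ ⇒ ⟨ a ⟩)
    rule-r : ∀ {a b c d} → (a , b , c , d) ∈ R → ArrowOf (σRule (a , b , c , d)) r (⟨ d ⟩ ⇒ ⟨ b ⟩)
    rule-• : ∀ {a b c d} e → (a , b , c , d) ∈ R → ArrowOf (σRule (a , b , c , d)) • (⟨ e ⟩ ⇒ ⟨ e ⟩)

  arrow-of : ∀ {T σ ρ} → Admissible T → T ∋∩ σ ⇒ ρ → ∃ λ D → ∃ λ Y → ArrowOf T D Y × D ≃ σ × Y ≃ ρ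
  arrow-of (assumption asm-σ0) (inj₁ q) = _ , _ , σ0-• , q
  arrow-of (assumption asm-σ0) (inj₂ (inj₁ q)) = _ , _ , σ0-l , q
  arrow-of (assumption asm-σ0) (inj₂ (inj₂ q)) = _ , _ , σ0-r , q
  arrow-of (assumption asm-σ*) (inj₁ q) = _ , _ , σ*-• , q
  arrow-of (assumption asm-σ*) (inj₂ (inj₁ q)) = _ , _ , σ*-l , q
  arrow-of (assumption asm-σ*) (inj₂ (inj₂ q)) = _ , _ , σ*-r• , q
  arrow-of (assumption (asm-rule mem)) (inj₁ q) = _ , _ , rule-l mem , q
  arrow-of (assumption (asm-rule mem)) (inj₂ (inj₁ q)) = _ , _ , rule-r mem , q
  arrow-of (assumption (asm-rule mem)) (inj₂ (inj₂ q)) with ⋂-∋∩ m _ _ q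
  ... | e , q' = _ , _ , rule-• e mem , q'

  data ArrowShape (D Y : Ty m) : Set where
    higher-order : ∀ {a b α} → D ∋∩ a ⇒ b → Y ∋∩ at α → ArrowShape D Y
    marker-arg   : ∀ {β a b} → Marker β → D ∋∩ at β → Y ∋∩ a ⇒ b → ArrowShape D Y
    symbol-arg   : ∀ {e α} → D ∋∩ ⟨ e ⟩ → Y ∋∩ at α → ArrowShape D Y

  arrow-shape : ∀ {T D' Y' D Y} → ArrowOf T D' Y' → D ≲ D' → Y ≲ Y' → ArrowShape D Y
  arrow-shape σ0-• p q = higher-order p q
  arrow-shape σ0-l p q = higher-order p q
  arrow-shape σ0-r p q = higher-order p q
  arrow-shape σ*-• p q = higher-order p q
  arrow-shape σ*-l p q = higher-order p q
  arrow-shape σ*-r• (p , _) q = higher-order p q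
  arrow-shape (rule-l _) p q = marker-arg marker-l p q
  arrow-shape (rule-r _) p q = marker-arg marker-r p q
  arrow-shape (rule-• _ _) p q = marker-arg marker-• p q

  result-arrow-shape : ∀ {T D' Y' D Y} → ArrowOf T D' Y' → Y' ∋∩ D ⇒ Y → ArrowShape D Y
  result-arrow-shape σ0-• ()
  result-arrow-shape σ0-l ()
  result-arrow-shape σ0-r ()
  result-arrow-shape σ*-• ()
  result-arrow-shape σ*-l ()
  result-arrow-shape σ*-r• ()
  result-arrow-shape (rule-l _) (p , q) = symbol-arg (≲-from p) (≲-from q)
  result-arrow-shape (rule-r _) (p , q) = symbol-arg (≲-from p) (≲-from q)
  result-arrow-shape (rule-• _ _) (p , q) = symbol-arg (≲-from p) (≲-from q)

  no-arrow-after-two-args : ∀ {T D' Y' σ ρ D Y} → ArrowOf T D' Y' → Y' ∋∩ σ ⇒ ρ → ¬ ρ ∋∩ D ⇒ Y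
  no-arrow-after-two-args σ0-• () _
  no-arrow-after-two-args σ0-l () _
  no-arrow-after-two-args σ0-r () _
  no-arrow-after-two-args σ*-• () _
  no-arrow-after-two-args σ*-l () _
  no-arrow-after-two-args σ*-r• () _
  no-arrow-after-two-args {D = D} {Y} (rule-l {a = a} _) (_ , p) q = ≲-∋∩ ⟨ a ⟩ _ (D ⇒ Y) (≲-to p) q
  no-arrow-after-two-args {D = D} {Y} (rule-r {b = b} _) (_ , p) q = ≲-∋∩ ⟨ b ⟩ _ (D ⇒ Y) (≲-to p) q
  no-arrow-after-two-args {D = D} {Y} (rule-• e _) (_ , p) q = ≲-∋∩ ⟨ e ⟩ _ (D ⇒ Y) (≲-to p) q

  data σ0-Body {n} (Γ : Ctx m n) (B : Term (suc n)) (g : Atom m) : Set where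
    •-body : star ≡ g → (• ∷ Γ) ⊢ⁿᶠ B ∶ ⟨ s0 ⟩ → σ0-Body Γ B g
    l-body : hash ≡ g → (l ∷ Γ) ⊢ⁿᶠ B ∶ ⟨ s0 ⟩ → σ0-Body Γ B g
    r-body : dollar ≡ g → (r ∷ Γ) ⊢ⁿᶠ B ∶ ⟨ s0 ⟩ → σ0-Body Γ B g

  data σ*-Body {n} (Γ : Ctx m n) (B : Term (suc n)) (g : Atom m) : Set where
    •-body  : star ≡ g → (• ∷ Γ) ⊢ⁿᶠ B ∶ * → σ*-Body Γ B g
    l-body  : hash ≡ g → (l ∷ Γ) ⊢ⁿᶠ B ∶ * → σ*-Body Γ B g
    r•-body : dollar ≡ g → (r ∷ Γ) ⊢ⁿᶠ B ∶ # → (• ∷ Γ) ⊢ⁿᶠ B ∶ $ → σ*-Body Γ B g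

  data RuleArgs {n} (Γ : Ctx m n) (A B : Term n) (g : Atom m) (a b c d : Sym m) : Set where
    l-args : Γ ⊢ⁿᶠ A ∶ l → sym a ≡ g → Γ ⊢ⁿᶠ B ∶ ⟨ c ⟩ → RuleArgs Γ A B g a b c d
    r-args : Γ ⊢ⁿᶠ A ∶ r → sym b ≡ g → Γ ⊢ⁿᶠ B ∶ ⟨ d ⟩ → RuleArgs Γ A B g a b c d
    •-args : ∀ {e} → Γ ⊢ⁿᶠ A ∶ • → sym e ≡ g → Γ ⊢ⁿᶠ B ∶ ⟨ e ⟩ → RuleArgs Γ A B g a b c d

  data HeadView {n} (Γ : Ctx m n) : Term n → Atom m → Set where
    σ1-head     : ∀ {x g} → lookup Γ x ≡ σ1 → sym s1 ≡ g → HeadView Γ (var x) g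
    marker-head : ∀ {x g} → lookup Γ x ≡ at g → Marker g → HeadView Γ (var x) g
    σ0-head     : ∀ {x B g} → lookup Γ x ≡ σ0 → σ0-Body Γ B g → HeadView Γ (app (var x) (lam B)) g
    σ*-head     : ∀ {x B g} → lookup Γ x ≡ σ* → σ*-Body Γ B g → HeadView Γ (app (var x) (lam B)) g
    rule-head   : ∀ {x A B g a b c d} → (a , b , c , d) ∈ R → lookup Γ x ≡ σRule (a , b , c , d) →
                  RuleArgs Γ A B g a b c d → HeadView Γ (app (app (var x) A) B) g

  record RuleTrack {n} (Γ : Ctx m n) (B : Term n) (g β : Atom m) (a b c d : Sym m) : Set where
    field
      at-l : β ≡ atl → sym a ≡ g × Γ ⊢ⁿᶠ B ∶ ⟨ c ⟩
      at-r : β ≡ atr → sym b ≡ g × Γ ⊢ⁿᶠ B ∶ ⟨ d ⟩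
      at-• : β ≡ bullet → Γ ⊢ⁿᶠ B ∶ at g
  open RuleTrack public

  module _ {n} {Γ : Ctx m n} (ok : ∀ x → Admissible (lookup Γ x)) where

    spine-view-admissible : ∀ {N τ} c → Γ ⊢ⁿᵉ N ∶ τ → τ ∋∩ c → SpineView Γ N c
    spine-view-admissible = spine-view (λ x → arity-admissible (ok x))

    ne-arrow-shape : ∀ {N D Y} → Γ ⊢ⁿᵉ N ∶ D ⇒ Y → ArrowShape D Y
    ne-arrow-shape {D = D} {Y} d with spine-view-admissible (D ⇒ Y) d (∋∩-⇒-refl D Y)
    ... | head₀ {x} q with arrow-of (ok x) q
    ...   | _ , _ , comp , D'≃D , Y'≃Y = arrow-shape comp (≲-from D'≃D) (≲-from Y'≃Y)
    ne-arrow-shape d | head₁ {x} q _ q₁ with arrow-of (ok x) q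
    ...   | _ , _ , comp , _ , Y'≃ρ = result-arrow-shape comp (≲-∋∩ _ _ _ (≲-to Y'≃ρ) q₁)
    ne-arrow-shape d | head₂ {x} q _ q₂ _ q₁ with arrow-of (ok x) q
    ...   | _ , _ , comp , _ , Y'≃ρ' =
      ⊥-elim (no-arrow-after-two-args comp (≲-∋∩ _ _ _ (≲-to Y'≃ρ') q₂) q₁)

    lam-view : ∀ {A X D Y} → Γ ⊢ⁿᶠ A ∶ X → X ∋∩ D ⇒ Y → ¬ ArrowShape D Y →
               ∃ λ B → A ≡ lam B × (D ∷ Γ) ⊢ⁿᶠ B ∶ Y
    lam-view d q ¬shape with nf-view _ d q
    ... | view-lam dB = _ , refl , dB
    ... | view-ne dN = ⊥-elim (¬shape (ne-arrow-shape dN))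

    marker-lam-view : ∀ {A X β γ} → Γ ⊢ⁿᶠ A ∶ X → X ∋∩ at β ⇒ at γ → Marker β →
                      ∃ λ B → A ≡ lam B × (at β ∷ Γ) ⊢ⁿᶠ B ∶ at γ
    marker-lam-view d q mk = lam-view d q (no-shape mk)
      where
      no-shape : ∀ {β γ} → Marker β → ¬ ArrowShape (at β) (at γ)
      no-shape marker-l (symbol-arg () _)
      no-shape marker-r (symbol-arg () _)
      no-shape marker-• (symbol-arg () _)

    var-head : ∀ {x g} T → Admissible T → lookup Γ x ≡ T → T ∋∩ at g → HeadView Γ (var x) g
    var-head T adm eq q with atom-of adm q
    ... | σ1-atom = σ1-head eq refl
    ... | marker-atom mk = marker-head eq mk

    app-head : ∀ {x T D Y A g} → ArrowOf T D Y → lookup Γ x ≡ T → Γ ⊢ⁿᶠ A ∶ D → Y ∋∩ at g →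
               HeadView Γ (app (var x) A) g
    app-head σ0-• eq dA e with marker-lam-view dA (∋∩-⇒-refl • ⟨ s0 ⟩) marker-•
    ... | _ , refl , dB = σ0-head eq (•-body e dB)
    app-head σ0-l eq dA e with marker-lam-view dA (∋∩-⇒-refl l ⟨ s0 ⟩) marker-l
    ... | _ , refl , dB = σ0-head eq (l-body e dB)
    app-head σ0-r eq dA e with marker-lam-view dA (∋∩-⇒-refl r ⟨ s0 ⟩) marker-r
    ... | _ , refl , dB = σ0-head eq (r-body e dB)
    app-head σ*-• eq dA e with marker-lam-view dA (∋∩-⇒-refl • *) marker-•
    ... | _ , refl , dB = σ*-head eq (•-body e dB)
    app-head σ*-l eq dA e with marker-lam-view dA (∋∩-⇒-refl l *) marker-l
    ... | _ , refl , dB = σ*-head eq (l-body e dB)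
    app-head σ*-r• eq dA e with marker-lam-view dA (inj₁ (∋∩-⇒-refl r #)) marker-r
                               | marker-lam-view dA (inj₂ (∋∩-⇒-refl • $)) marker-•
    ... | _ , refl , dB | _ , refl , dB' = σ*-head eq (r•-body e dB dB')
    app-head (rule-l _) eq dA ()
    app-head (rule-r _) eq dA ()
    app-head (rule-• _ _) eq dA ()

    app₂-head : ∀ {x T D Y A B σ ρ g} → ArrowOf T D Y → lookup Γ x ≡ T → Γ ⊢ⁿᶠ A ∶ D →
                Y ∋∩ σ ⇒ ρ → Γ ⊢ⁿᶠ B ∶ σ → ρ ∋∩ at g → HeadView Γ (app (app (var x) A) B) g
    app₂-head σ0-• eq dA () dB q
    app₂-head σ0-l eq dA () dB q
    app₂-head σ0-r eq dA () dB q
    app₂-head σ*-• eq dA () dB q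
    app₂-head σ*-l eq dA () dB q
    app₂-head σ*-r• eq dA () dB q
    app₂-head (rule-l {a = a} mem) eq dA (p , p') dB q =
      rule-head mem eq (l-args dA (≲-∋∩ ⟨ a ⟩ _ _ (≲-to p') q) (nf-≃ dB (≃-sym p)))
    app₂-head (rule-r {b = b} mem) eq dA (p , p') dB q =
      rule-head mem eq (r-args dA (≲-∋∩ ⟨ b ⟩ _ _ (≲-to p') q) (nf-≃ dB (≃-sym p)))
    app₂-head (rule-• e mem) eq dA (p , p') dB q =
      rule-head mem eq (•-args dA (≲-∋∩ ⟨ e ⟩ _ _ (≲-to p') q) (nf-≃ dB (≃-sym p)))

    head-view : ∀ {N g} → Γ ⊢ⁿᶠ N ∶ at g → HeadView Γ N g
    head-view {g = g} d with nf-view (at g) d refl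
    ... | view-ne dN with spine-view-admissible (at g) dN refl
    ...   | head₀ {x} q = var-head _ (ok x) refl q
    ...   | head₁ {x} q dA q₁ with arrow-of (ok x) q
    ...     | _ , _ , comp , D≃σ , Y≃ρ =
      app-head comp refl (nf-≃ dA (≃-sym D≃σ)) (≲-∋∩ _ _ _ (≲-to Y≃ρ) q₁)
    head-view d | view-ne dN | head₂ {x} q dA q₂ dB q₁ with arrow-of (ok x) q
    ...     | _ , _ , comp , D≃σ' , Y≃ρ' =
      app₂-head comp refl (nf-≃ dA (≃-sym D≃σ')) (≲-∋∩ _ _ _ (≲-to Y≃ρ') q₂) dB q₁

    marker-var : ∀ {A β} → Marker β → Γ ⊢ⁿᶠ A ∶ at β → ∃ λ u → A ≡ var u × lookup Γ u ≡ at β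
    marker-var mk d = marker-head-var mk (head-view d)
      where
      marker-head-var : ∀ {A β} → Marker β → HeadView Γ A β → ∃ λ u → A ≡ var u × lookup Γ u ≡ at β
      marker-head-var mk (marker-head eq _) = _ , refl , eq
      marker-head-var () (σ1-head _ refl)
      marker-head-var () (σ0-head _ (•-body refl _))
      marker-head-var () (σ0-head _ (l-body refl _))
      marker-head-var () (σ0-head _ (r-body refl _))
      marker-head-var () (σ*-head _ (•-body refl _))
      marker-head-var () (σ*-head _ (l-body refl _))
      marker-head-var () (σ*-head _ (r•-body refl _ _))
      marker-head-var () (rule-head _ _ (l-args _ refl _))
      marker-head-var () (rule-head _ _ (r-args _ refl _))
      marker-head-var () (rule-head _ _ (•-args _ refl _))

    rule-marker : ∀ {A B g a b c d} → RuleArgs Γ A B g a b c d →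
                  ∃ λ u → A ≡ var u × ∃ λ β → Marker β × lookup Γ u ≡ at β
    rule-marker (l-args dA _ _) with marker-var marker-l dA
    ... | u , e , eq = u , e , _ , marker-l , eq
    rule-marker (r-args dA _ _) with marker-var marker-r dA
    ... | u , e , eq = u , e , _ , marker-r , eq
    rule-marker (•-args dA _ _) with marker-var marker-• dA
    ... | u , e , eq = u , e , _ , marker-• , eq

    σ0-track : ∀ {x B g} → lookup Γ x ≡ σ0 → Γ ⊢ⁿᶠ app (var x) (lam B) ∶ at g → σ0-Body Γ B g
    σ0-track eq d with head-view d
    ... | σ0-head _ body = body
    ... | σ*-head eq' _ with trans (≡.sym eq) eq'
    ...   | ()

    σ*-track : ∀ {x B g} → lookup Γ x ≡ σ* → Γ ⊢ⁿᶠ app (var x) (lam B) ∶ at g → σ*-Body Γ B g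
    σ*-track eq d with head-view d
    ... | σ*-head _ body = body
    ... | σ0-head eq' _ with trans (≡.sym eq) eq'
    ...   | ()

    σ1-track : ∀ {x g} → lookup Γ x ≡ σ1 → Γ ⊢ⁿᶠ var x ∶ at g → sym s1 ≡ g
    σ1-track eq d with head-view d
    ... | σ1-head _ e = e
    ... | marker-head eq' mk = ⊥-elim (assumption-not-marker asm-σ1 mk (trans (≡.sym eq) eq'))

    rule-track : ∀ {y u B g β a b c d} → lookup Γ y ≡ σRule (a , b , c , d) → lookup Γ u ≡ at β →
                 Γ ⊢ⁿᶠ app (app (var y) (var u)) B ∶ at g → RuleTrack Γ B g β a b c d
    rule-track {u = u} {B} {g} {β} eq eqᵤ d with head-view d
    ... | rule-head _ eq' args with trans (≡.sym eq) eq'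
    ...   | refl = args-track args
      where
      marker-type : ∀ {β'} → Marker β' → Γ ⊢ⁿᶠ var u ∶ at β' → β ≡ β'
      marker-type mk dA with marker-var mk dA
      ... | _ , refl , eq'' with trans (≡.sym eqᵤ) eq''
      ...   | refl = refl

      args-track : ∀ {a b c d} → RuleArgs Γ (var u) B g a b c d → RuleTrack Γ B g β a b c d
      args-track (l-args dA e dB) with marker-type marker-l dA
      ... | refl = record { at-l = λ _ → e , dB ; at-r = λ () ; at-• = λ () }
      args-track (r-args dA e dB) with marker-type marker-r dA
      ... | refl = record { at-l = λ () ; at-r = λ _ → e , dB ; at-• = λ () }
      args-track (•-args dA e dB) with marker-type marker-• dA
      ... | refl = record { at-l = λ () ; at-r = λ () ; at-• = λ _ → subst (λ h → Γ ⊢ⁿᶠ B ∶ at h) e dB }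

module Columns {m : ℕ} (s0 s1 : Sym m) (R : List (Rule m)) where
  open Encoding s0 s1
  open HeadAnalysis s0 s1 R

  colAtom : ℕ → ℕ → Atom m
  colAtom zero zero = atl
  colAtom zero (suc zero) = atr
  colAtom zero (suc (suc j)) = bullet
  colAtom (suc i) zero = bullet
  colAtom (suc i) (suc j) = colAtom i j

  colAtom-marker : ∀ i j → Marker (colAtom i j)
  colAtom-marker zero zero = marker-l
  colAtom-marker zero (suc zero) = marker-r
  colAtom-marker zero (suc (suc j)) = marker-•
  colAtom-marker (suc i) zero = marker-•
  colAtom-marker (suc i) (suc j) = colAtom-marker i j

  colAtom-< : ∀ i j → j < i → colAtom i j ≡ bullet
  colAtom-< (suc i) zero _ = refl
  colAtom-< (suc i) (suc j) (s≤s j<i) = colAtom-< i j j<i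

  colAtom-≡ : ∀ i → colAtom i i ≡ atl
  colAtom-≡ zero = refl
  colAtom-≡ (suc i) = colAtom-≡ i

  colAtom-suc : ∀ i → colAtom i (suc i) ≡ atr
  colAtom-suc zero = refl
  colAtom-suc (suc i) = colAtom-suc i

  colAtom-other : ∀ i j → j ≢ i → j ≢ suc i → colAtom i j ≡ bullet
  colAtom-other zero zero j≢i _ = ⊥-elim (j≢i refl)
  colAtom-other zero (suc zero) _ j≢1+i = ⊥-elim (j≢1+i refl)
  colAtom-other zero (suc (suc j)) _ _ = refl
  colAtom-other (suc i) zero _ _ = refl
  colAtom-other (suc i) (suc j) j≢i j≢1+i =
    colAtom-other i j (λ e → j≢i (cong suc e)) (λ e → j≢1+i (cong suc e))

  colAtom-far : ∀ i j → suc i < j → colAtom i j ≡ bullet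
  colAtom-far i j 1+i<j =
    colAtom-other i j (λ { refl → n≮n _ (≤-trans (n≤1+n _) 1+i<j) }) (λ { refl → n≮n _ 1+i<j })

  goalAtom : ℕ → ℕ → Atom m
  goalAtom zero zero = hash
  goalAtom zero (suc _) = dollar
  goalAtom (suc p) zero = star
  goalAtom (suc p) (suc j) = goalAtom p j

  goalAtom-< : ∀ p j → j < p → goalAtom p j ≡ star
  goalAtom-< (suc p) zero _ = refl
  goalAtom-< (suc p) (suc j) (s≤s j<p) = goalAtom-< p j j<p

  goalAtom-≡ : ∀ p → goalAtom p p ≡ hash
  goalAtom-≡ zero = refl
  goalAtom-≡ (suc p) = goalAtom-≡ p

  goalAtom-suc : ∀ p → goalAtom p (suc p) ≡ dollar
  goalAtom-suc zero = refl
  goalAtom-suc (suc p) = goalAtom-suc p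

  star-goal⇒• : ∀ p j → star ≡ goalAtom p j → colAtom p j ≡ bullet
  star-goal⇒• zero zero ()
  star-goal⇒• zero (suc j) ()
  star-goal⇒• (suc p) zero _ = refl
  star-goal⇒• (suc p) (suc j) e = star-goal⇒• p j e

  hash-goal⇒l : ∀ p j → hash ≡ goalAtom p j → colAtom p j ≡ atl
  hash-goal⇒l zero zero _ = refl
  hash-goal⇒l zero (suc j) ()
  hash-goal⇒l (suc p) zero ()
  hash-goal⇒l (suc p) (suc j) e = hash-goal⇒l p j e

  dollar-goal⇒r : ∀ p j → j ≤ suc p → dollar ≡ goalAtom p j → colAtom p j ≡ atr
  dollar-goal⇒r zero zero _ ()
  dollar-goal⇒r zero (suc zero) _ _ = refl
  dollar-goal⇒r zero (suc (suc j)) (s≤s ()) _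
  dollar-goal⇒r (suc p) zero _ ()
  dollar-goal⇒r (suc p) (suc j) (s≤s j≤1+p) e = dollar-goal⇒r p j j≤1+p e

  dollar-goal⇒> : ∀ p j → dollar ≡ goalAtom p j → p < j
  dollar-goal⇒> zero zero ()
  dollar-goal⇒> zero (suc j) _ = s≤s z≤n
  dollar-goal⇒> (suc p) zero ()
  dollar-goal⇒> (suc p) (suc j) e = s≤s (dollar-goal⇒> p j e)

  data ColumnPos (p : ℕ) : ℕ → Set where
    left   : ∀ {j} → j < p → ColumnPos p j
    centre : ColumnPos p p
    right  : ColumnPos p (suc p)

  column-pos : ∀ p j → j ≤ suc p → ColumnPos p j
  column-pos zero zero _ = centre
  column-pos zero (suc zero) _ = right
  column-pos zero (suc (suc j)) (s≤s ())
  column-pos (suc p) zero _ = left (s≤s z≤n)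
  column-pos (suc p) (suc j) (s≤s j≤1+p) with column-pos p j j≤1+p
  ... | left j<p = left (s≤s j<p)
  ... | centre = centre
  ... | right = right

  colCtx : ∀ {q} (p : ℕ) → ℕ → Ctx m q → Ctx m (p + q)
  colCtx zero j Γ = Γ
  colCtx (suc p) j Γ = at (colAtom p j) ∷ colCtx p j Γ

  colCtx-far : ∀ {q} (Γ : Ctx m q) p j j' → p < j → p < j' → colCtx p j Γ ≡ colCtx p j' Γ
  colCtx-far Γ zero j j' _ _ = refl
  colCtx-far Γ (suc p) j j' p<j p<j' =
    cong₂ (λ β Δ → at β ∷ Δ) (trans (colAtom-far p j p<j) (≡.sym (colAtom-far p j' p<j')))
      (colCtx-far Γ p j j' (≤-trans (n≤1+n _) p<j) (≤-trans (n≤1+n _) p<j'))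

  lookup-colCtx-↑ʳ : ∀ {q} p j (Γ : Ctx m q) k → lookup (colCtx p j Γ) (p ↑ʳ k) ≡ lookup Γ k
  lookup-colCtx-↑ʳ zero j Γ k = refl
  lookup-colCtx-↑ʳ (suc p) j Γ k = lookup-colCtx-↑ʳ p j Γ k

  module _ {q} (Γ : Ctx m q) where

    data ColumnVar (p : ℕ) (x : Fin (p + q)) : Set where
      bound-marker : ∀ i → i < p → (∀ j → lookup (colCtx p j Γ) x ≡ at (colAtom i j)) → ColumnVar p x
      from-context : ∀ k → (∀ j → lookup (colCtx p j Γ) x ≡ lookup Γ k) → ColumnVar p x

    column-var : ∀ p x → ColumnVar p x
    column-var zero x = from-context x (λ _ → refl)
    column-var (suc p) zero = bound-marker p ≤-refl (λ _ → refl)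
    column-var (suc p) (suc x) with column-var p x
    ... | bound-marker i i<p f = bound-marker i (≤-trans i<p (n≤1+n p)) f
    ... | from-context k f = from-context k f

    marker-index : ∀ p i → i < p → ∃ λ u → ∀ j → lookup (colCtx p j Γ) u ≡ at (colAtom i j)
    marker-index (suc p) i i<1+p with i ≟ p
    ... | yes refl = zero , λ _ → refl
    ... | no i≢p with marker-index p i (≤∧≢⇒< (≤-pred i<1+p) i≢p)
    ...   | u , f = suc u , f

    module _ (asm : Assumptions Γ) where

      column-admissible : ∀ p j x → Admissible (lookup (colCtx p j Γ) x)
      column-admissible zero j x = assumptions⇒admissible {Γ = Γ} asm x
      column-admissible (suc p) j zero = marker (colAtom-marker p j)
      column-admissible (suc p) j (suc x) = column-admissible p j x

      lookup-column-independent : ∀ {T} → Assumption T → ∀ p {x} j j' →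
                                  lookup (colCtx p j Γ) x ≡ T → lookup (colCtx p j' Γ) x ≡ T
      lookup-column-independent asmT p {x} j j' eq with column-var p x
      ... | bound-marker i _ f = ⊥-elim (assumption-not-marker asmT (colAtom-marker i j) (trans (≡.sym eq) (f j)))
      ... | from-context k f = trans (f j') (trans (≡.sym (f j)) eq)

    Columnwise : (∀ {n} → Ctx m n → Term n → Ty m → Set) → ∀ p → ℕ → (ℕ → Ty m) → Term (p + q) → Set
    Columnwise _⊢_∶_ p k τ P = ∀ j → j ≤ k → colCtx p j Γ ⊢ P ∶ τ j

module Words {m : ℕ} (R : List (Rule m)) where

  -- Out of range, symbolAt returns the junk letter zero; it is only used below the length.
  symbolAt : List (Sym m) → ℕ → Sym m
  symbolAt [] _ = zero
  symbolAt (a ∷ _) zero = a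
  symbolAt (_ ∷ w) (suc j) = symbolAt w j

  symbolAt-replicate : ∀ k (a : Sym m) {j} → j < k → symbolAt (replicate k a) j ≡ a
  symbolAt-replicate (suc k) a {zero} _ = refl
  symbolAt-replicate (suc k) a {suc j} (s≤s j<k) = symbolAt-replicate k a j<k

  replicate-symbolAt : ∀ (a : Sym m) w → (∀ j → j < length w → symbolAt w j ≡ a) → w ≡ replicate (length w) a
  replicate-symbolAt a [] _ = refl
  replicate-symbolAt a (b ∷ w) all-a =
    cong₂ _∷_ (all-a 0 (s≤s z≤n)) (replicate-symbolAt a w (λ j j< → all-a (suc j) (s≤s j<)))

  record RewriteAt (i : ℕ) (a b c d : Sym m) (w w' : List (Sym m)) : Set where
    field
      in-range : suc i < length w
      length-≡ : length w' ≡ length w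
      old₁     : symbolAt w i ≡ a
      old₂     : symbolAt w (suc i) ≡ b
      new₁     : symbolAt w' i ≡ c
      new₂     : symbolAt w' (suc i) ≡ d
      frame    : ∀ j → j ≢ i → j ≢ suc i → symbolAt w' j ≡ symbolAt w j
  open RewriteAt public

  rewriteAt-here : ∀ {a b c d : Sym m} y → RewriteAt 0 a b c d (a ∷ b ∷ y) (c ∷ d ∷ y)
  rewriteAt-here {a} {b} {c} {d} y = record
    { in-range = s≤s (s≤s z≤n) ; length-≡ = refl
    ; old₁ = refl ; old₂ = refl ; new₁ = refl ; new₂ = refl ; frame = frame-here }
    where
    frame-here : ∀ j → j ≢ 0 → j ≢ 1 → symbolAt (c ∷ d ∷ y) j ≡ symbolAt (a ∷ b ∷ y) j
    frame-here zero j≢0 _ = ⊥-elim (j≢0 refl)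
    frame-here (suc zero) _ j≢1 = ⊥-elim (j≢1 refl)
    frame-here (suc (suc j)) _ _ = refl

  rewriteAt-∷ : ∀ {i a b c d w w'} z → RewriteAt i a b c d w w' → RewriteAt (suc i) a b c d (z ∷ w) (z ∷ w')
  rewriteAt-∷ {i} {w = w} {w'} z rw = record
    { in-range = s≤s (in-range rw) ; length-≡ = cong suc (length-≡ rw)
    ; old₁ = old₁ rw ; old₂ = old₂ rw ; new₁ = new₁ rw ; new₂ = new₂ rw ; frame = frame-∷ }
    where
    frame-∷ : ∀ j → j ≢ suc i → j ≢ suc (suc i) → symbolAt (z ∷ w') j ≡ symbolAt (z ∷ w) j
    frame-∷ zero _ _ = refl
    frame-∷ (suc j) j≢ j≢' = frame rw j (λ e → j≢ (cong suc e)) (λ e → j≢' (cong suc e))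

  rewriteAt-step : ∀ {a b c d : Sym m} x y → RewriteAt (length x) a b c d (x ++ a ∷ b ∷ y) (x ++ c ∷ d ∷ y)
  rewriteAt-step [] y = rewriteAt-here y
  rewriteAt-step (z ∷ x) y = rewriteAt-∷ z (rewriteAt-step x y)

  step-∷ : ∀ {w w'} z → Step R w w' → Step R (z ∷ w) (z ∷ w')
  step-∷ z (step x y mem) = step (z ∷ x) y mem

  rewrite-at : ∀ {a b c d} w i → suc i < length w → (a , b , c , d) ∈ R →
               symbolAt w i ≡ a → symbolAt w (suc i) ≡ b →
               ∃ λ w' → Step R w w' × RewriteAt i a b c d w w'
  rewrite-at (_ ∷ _ ∷ y) zero _ mem refl refl = _ , step [] y mem , rewriteAt-here y
  rewrite-at (z ∷ w) (suc i) (s≤s in-range) mem e₁ e₂ with rewrite-at w i in-range mem e₁ e₂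
  ... | w' , st , rw = z ∷ w' , step-∷ z st , rewriteAt-∷ z rw

  step-++ʳ : ∀ {u v} z → Step R u v → Step R (u ++ z) (v ++ z)
  step-++ʳ z (step {a} {b} {c} {d} x y mem) =
    subst₂ (Step R) (≡.sym (++-assoc x (a ∷ b ∷ y) z)) (≡.sym (++-assoc x (c ∷ d ∷ y) z)) (step x (y ++ z) mem)

  step-++ˡ : ∀ {u v} z → Step R u v → Step R (z ++ u) (z ++ v)
  step-++ˡ z (step {a} {b} {c} {d} x y mem) =
    subst₂ (Step R) (++-assoc z x (a ∷ b ∷ y)) (++-assoc z x (c ∷ d ∷ y)) (step (z ++ x) y mem)

  replicate-+ : ∀ k k' (a : Sym m) → replicate (k + k') a ≡ replicate k a ++ replicate k' a
  replicate-+ zero k' a = refl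
  replicate-+ (suc k) k' a = cong (a ∷_) (replicate-+ k k' a)

  ↠-replicate-+ : ∀ {s t : Sym m} k k' → R ⊢ replicate k s ↠ replicate k t → R ⊢ replicate k' s ↠ replicate k' t →
                  R ⊢ replicate (k + k') s ↠ replicate (k + k') t
  ↠-replicate-+ {s} {t} k k' p q =
    subst₂ (R ⊢_↠_) (≡.sym (replicate-+ k k' s)) (≡.sym (replicate-+ k k' t))
      (Star.gmap (_++ replicate k' s) (step-++ʳ _) p ◅◅ Star.gmap (replicate k t ++_) (step-++ˡ _) q)

module Binders {m : ℕ} (s0 s1 : Sym m) (R : List (Rule m)) where
  open Encoding s0 s1
  open HeadAnalysis s0 s1 R

  target : Ty m
  target = (l ⇒ *) ∩ (r ⇒ #) ∩ (• ⇒ $)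

  Γ₃ : Ctx m 3
  Γ₃ = σ1 ∷ σ* ∷ σ0 ∷ []

  Γ₃-assumptions : Assumptions Γ₃
  Γ₃-assumptions = assumptions-∷ asm-σ1 (assumptions-∷ asm-σ* (assumptions-∷ asm-σ0 (λ ())))

  size : List (Rule m) → ℕ → ℕ
  size [] n = n
  size (_ ∷ ts) n = size ts (suc n)

  bindRules : ∀ R' {n} → Ctx m n → Ctx m (size R' n)
  bindRules [] Γ = Γ
  bindRules (t ∷ ts) Γ = bindRules ts (σRule t ∷ Γ)

  weakenRules : ∀ R' {n} → Fin n → Fin (size R' n)
  weakenRules [] k = k
  weakenRules (t ∷ ts) k = weakenRules ts (suc k)

  lookup-weakenRules : ∀ R' {n} (Γ : Ctx m n) k → lookup (bindRules R' Γ) (weakenRules R' k) ≡ lookup Γ k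
  lookup-weakenRules [] Γ k = refl
  lookup-weakenRules (t ∷ ts) Γ k = lookup-weakenRules ts (σRule t ∷ Γ) (suc k)

  rule-index : ∀ R' {n} (Γ : Ctx m n) {t} → t ∈ R' → ∃ λ k → lookup (bindRules R' Γ) k ≡ σRule t
  rule-index (t ∷ ts) Γ (here refl) = weakenRules ts zero , lookup-weakenRules ts (σRule t ∷ Γ) zero
  rule-index (t ∷ ts) Γ (there mem) = rule-index ts (σRule t ∷ Γ) mem

  bindRules-assumptions : ∀ R' → (∀ {t} → t ∈ R' → t ∈ R) → ∀ {n} {Γ : Ctx m n} →
                          Assumptions Γ → Assumptions (bindRules R' Γ)
  bindRules-assumptions [] _ asm = asm
  bindRules-assumptions ((a , b , c , d) ∷ ts) ⊆R asm =
    bindRules-assumptions ts (λ mem → ⊆R (there mem)) (assumptions-∷ (asm-rule (⊆R (here refl))) asm)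

  Γ⋆ : Ctx m (size R 3)
  Γ⋆ = bindRules R Γ₃

  Γ⋆-assumptions : Assumptions Γ⋆
  Γ⋆-assumptions = bindRules-assumptions R (λ mem → mem) Γ₃-assumptions

module Soundness {m : ℕ} (s0 s1 : Sym m) (R : List (Rule m)) where
  open Encoding s0 s1
  open Subtyping {m}
  open Normalisation {m}
  open HeadAnalysis s0 s1 R
  open Columns s0 s1 R
  open Words R
  open Binders s0 s1 R

  Solvable : Set
  Solvable = ∃ λ n → n ≥ 1 × R ⊢ replicate n s0 ↠ replicate n s1

  retype : ∀ {n} {Δ Δ' : Ctx m n} {B τ τ'} → Δ ≡ Δ' → τ ≡ τ' → Δ ⊢ⁿᶠ B ∶ τ → Δ' ⊢ⁿᶠ B ∶ τ'
  retype refl refl d = d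

  module _ {q} (Γ : Ctx m q) (asm : Assumptions Γ) where

    private
      ok : ∀ p j x → Admissible (lookup (colCtx p j Γ) x)
      ok = column-admissible Γ asm

      same-type : ∀ {T} → Assumption T → ∀ p {x} j j' → lookup (colCtx p j Γ) x ≡ T → lookup (colCtx p j' Γ) x ≡ T
      same-type = lookup-column-independent Γ asm

    StarTyped : ∀ p → Term (p + q) → Set
    StarTyped p = Columnwise Γ _⊢ⁿᶠ_∶_ p (suc p) (λ j → at (goalAtom p j))

    WordTyped : ∀ k → List (Sym m) → Term (k + q) → Set
    WordTyped k w = Columnwise Γ _⊢ⁿᶠ_∶_ k k (λ j → ⟨ symbolAt w j ⟩)

    rule-step : ∀ k {y u B w a b c d} i → i < k → (a , b , c , d) ∈ R →
                lookup (colCtx k 0 Γ) y ≡ σRule (a , b , c , d) →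
                (∀ j → lookup (colCtx k j Γ) u ≡ at (colAtom i j)) →
                length w ≡ suc k → WordTyped k w (app (app (var y) (var u)) B) →
                ∃ λ w' → Step R w w' × length w' ≡ suc k × WordTyped k w' B
    rule-step k {B = B} {w} {a} {b} {c} {d} i i<k mem eq u-type len typed =
      let (w' , st , rw) = rewrite-at w i (subst (suc i <_) (≡.sym len) (s≤s i<k)) mem a-at-i b-at-1+i
      in w' , st , trans (length-≡ rw) len , typed' rw
      where
      track : ∀ j → j ≤ k → RuleTrack (colCtx k j Γ) B (sym (symbolAt w j)) (colAtom i j) a b c d
      track j j≤k = rule-track (ok k j) (same-type (asm-rule mem) k 0 j eq) (u-type j) (typed j j≤k)

      a-at-i : symbolAt w i ≡ a
      a-at-i = sym-injective (≡.sym (proj₁ (at-l (track i (≤-trans (n≤1+n i) i<k)) (colAtom-≡ i))))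

      b-at-1+i : symbolAt w (suc i) ≡ b
      b-at-1+i = sym-injective (≡.sym (proj₁ (at-r (track (suc i) i<k) (colAtom-suc i))))

      typed' : ∀ {w'} → RewriteAt i a b c d w w' → WordTyped k w' B
      typed' rw j j≤k with j ≟ i | j ≟ suc i
      ... | yes refl | _ = retype refl (cong ⟨_⟩ (≡.sym (new₁ rw))) (proj₂ (at-l (track j j≤k) (colAtom-≡ j)))
      ... | no _ | yes refl = retype refl (cong ⟨_⟩ (≡.sym (new₂ rw))) (proj₂ (at-r (track j j≤k) (colAtom-suc i)))
      ... | no j≢i | no j≢1+i =
        retype refl (cong ⟨_⟩ (≡.sym (frame rw j j≢i j≢1+i))) (at-• (track j j≤k) (colAtom-other i j j≢i j≢1+i))

    word⇒↠ : ∀ k w (Q : Term (k + q)) → length w ≡ suc k → WordTyped k w Q → R ⊢ w ↠ replicate (suc k) s1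
    word⇒↠ k w Q len typed with head-view (ok k 0) (typed 0 z≤n)
    ... | σ1-head eq _ = subst (R ⊢ w ↠_) all-s1 ε
      where
      all-s1 : w ≡ replicate (suc k) s1
      all-s1 = trans (replicate-symbolAt s1 w (λ j j<len → sym-injective (≡.sym
                 (σ1-track (ok k j) (same-type asm-σ1 k 0 j eq) (typed j (≤-pred (subst (j <_) len j<len)))))))
               (cong (λ n → replicate n s1) len)
    ... | marker-head _ ()
    ... | σ0-head _ (•-body () _)
    ... | σ0-head _ (l-body () _)
    ... | σ0-head _ (r-body () _)
    ... | σ*-head _ (•-body () _)
    ... | σ*-head _ (l-body () _)
    ... | σ*-head _ (r•-body () _ _)
    ... | rule-head {B = B} mem eq args with rule-marker (ok k 0) args
    ...   | u , refl , _ , mk , eqᵤ with column-var Γ k u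
    ...     | from-context κ f = ⊥-elim (assumption-not-marker (asm κ) mk (trans (≡.sym (f 0)) eqᵤ))
    ...     | bound-marker i i<k f with rule-step k i i<k mem eq f len typed
    ...       | w' , st , len' , typed' = st ◅ word⇒↠ k w' B len' typed'

    σ0-step : ∀ p {x B} → lookup (colCtx p p Γ) x ≡ σ0 → StarTyped p (app (var x) (lam B)) →
              WordTyped (suc p) (replicate (suc (suc p)) s0) B
    σ0-step p {B = B} eq typed j j≤1+p =
      subst (λ e → colCtx (suc p) j Γ ⊢ⁿᶠ B ∶ ⟨ e ⟩) (≡.sym (symbolAt-replicate _ s0 (s≤s j≤1+p)))
        (σ0-column (σ0-track (ok p j) (same-type asm-σ0 p p j eq) (typed j j≤1+p)))
      where
      under : ∀ {β} → colAtom p j ≡ β → (at β ∷ colCtx p j Γ) ⊢ⁿᶠ B ∶ ⟨ s0 ⟩ → colCtx (suc p) j Γ ⊢ⁿᶠ B ∶ ⟨ s0 ⟩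
      under e = retype (cong (λ β → at β ∷ colCtx p j Γ) (≡.sym e)) refl

      σ0-column : σ0-Body (colCtx p j Γ) B (goalAtom p j) → colCtx (suc p) j Γ ⊢ⁿᶠ B ∶ ⟨ s0 ⟩
      σ0-column (•-body e dB) = under (star-goal⇒• p j e) dB
      σ0-column (l-body e dB) = under (hash-goal⇒l p j e) dB
      σ0-column (r-body e dB) = under (dollar-goal⇒r p j j≤1+p e) dB

    σ*-left : ∀ p j {B} → j ≤ p → σ*-Body (colCtx p j Γ) B (goalAtom p j) →
              colCtx (suc p) j Γ ⊢ⁿᶠ B ∶ at (goalAtom (suc p) j)
    σ*-left p j j≤p (•-body e dB) =
      retype (cong (λ β → at β ∷ colCtx p j Γ) (≡.sym (star-goal⇒• p j e)))
             (cong at (≡.sym (goalAtom-< (suc p) j (s≤s j≤p)))) dB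
    σ*-left p j j≤p (l-body e dB) =
      retype (cong (λ β → at β ∷ colCtx p j Γ) (≡.sym (hash-goal⇒l p j e)))
             (cong at (≡.sym (goalAtom-< (suc p) j (s≤s j≤p)))) dB
    σ*-left p j j≤p (r•-body e _ _) = ⊥-elim (<⇒≱ (dollar-goal⇒> p j e) j≤p)

    σ*-right : ∀ p {x B} → lookup (colCtx p p Γ) x ≡ σ* → StarTyped p (app (var x) (lam B)) →
               (r ∷ colCtx p (suc p) Γ) ⊢ⁿᶠ B ∶ # × (• ∷ colCtx p (suc p) Γ) ⊢ⁿᶠ B ∶ $
    σ*-right p eq typed =
      split (σ*-track (ok p (suc p)) (same-type asm-σ* p p (suc p) eq)
               (retype refl (cong at (goalAtom-suc p)) (typed (suc p) ≤-refl)))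
      where
      split : ∀ {n} {Δ : Ctx m n} {B} → σ*-Body Δ B dollar → (r ∷ Δ) ⊢ⁿᶠ B ∶ # × (• ∷ Δ) ⊢ⁿᶠ B ∶ $
      split (r•-body _ dB dB') = dB , dB'

    σ*-step : ∀ p {x B} → lookup (colCtx p p Γ) x ≡ σ* → StarTyped p (app (var x) (lam B)) → StarTyped (suc p) B
    σ*-step p eq typed j j≤ with column-pos (suc p) j j≤
    ... | left (s≤s j≤p) =
      σ*-left p j j≤p (σ*-track (ok p j) (same-type asm-σ* p p j eq) (typed j (≤-trans j≤p (n≤1+n p))))
    ... | centre =
      retype (cong (λ β → at β ∷ colCtx p (suc p) Γ) (≡.sym (colAtom-suc p)))
             (cong at (≡.sym (goalAtom-≡ (suc p)))) (proj₁ (σ*-right p eq typed))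
    ... | right =
      retype (cong₂ (λ β Δ → at β ∷ Δ) (≡.sym (colAtom-far p (suc (suc p)) ≤-refl))
                    (colCtx-far Γ p (suc p) (suc (suc p)) ≤-refl (n≤1+n _)))
             (cong at (≡.sym (goalAtom-suc (suc p)))) (proj₂ (σ*-right p eq typed))

    star⇒solvable : ∀ p (P : Term (p + q)) → StarTyped p P → Solvable
    star⇒solvable p P typed with head-view (ok p p) (retype refl (cong at (goalAtom-≡ p)) (typed p (n≤1+n p)))
    ... | σ1-head _ ()
    ... | marker-head _ ()
    ... | σ0-head _ (•-body () _)
    ... | σ0-head _ (r-body () _)
    ... | σ*-head _ (•-body () _)
    ... | σ*-head _ (r•-body () _ _)
    ... | rule-head _ _ (l-args _ () _)
    ... | rule-head _ _ (r-args _ () _)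
    ... | rule-head _ _ (•-args _ () _)
    ... | σ0-head {B = B} eq (l-body _ _) =
      suc (suc p) , s≤s z≤n , word⇒↠ (suc p) _ B (length-replicate _) (σ0-step p eq typed)
    ... | σ*-head {B = B} eq (l-body _ _) = star⇒solvable (suc p) B (σ*-step p eq typed)

  assumption-no-shape : ∀ {D Y} → Assumption D → (∀ {α} → ¬ Y ∋∩ at α) → ¬ ArrowShape D Y
  assumption-no-shape asmD no-atom (higher-order _ q) = no-atom q
  assumption-no-shape asmD no-atom (symbol-arg _ q) = no-atom q
  assumption-no-shape asmD no-atom (marker-arg mk p _) with atom-of (assumption asmD) p
  assumption-no-shape asmD no-atom (marker-arg () p _) | σ1-atom
  assumption-no-shape asmD no-atom (marker-arg mk p _) | marker-atom _ = assumption-not-marker asmD mk refl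

  peel : ∀ {n} {Γ : Ctx m n} {A D Y} → Assumptions Γ → Γ ⊢ⁿᶠ A ∶ D ⇒ Y → Assumption D →
         (∀ {α} → ¬ Y ∋∩ at α) → ∃ λ B → A ≡ lam B × (D ∷ Γ) ⊢ⁿᶠ B ∶ Y
  peel {Γ = Γ} asm d asmD no-atom =
    lam-view (assumptions⇒admissible {Γ = Γ} asm) d (∋∩-⇒-refl _ _) (assumption-no-shape asmD no-atom)

  rulesTo-target-no-atom : ∀ R' {α} → ¬ rulesTo R' target ∋∩ at α
  rulesTo-target-no-atom [] (inj₁ ())
  rulesTo-target-no-atom [] (inj₂ (inj₁ ()))
  rulesTo-target-no-atom [] (inj₂ (inj₂ ()))
  rulesTo-target-no-atom (_ ∷ _) ()

  peel-rules : ∀ R' → (∀ {t} → t ∈ R' → t ∈ R) → ∀ {n} {Γ : Ctx m n} {P} → Assumptions Γ →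
               Γ ⊢ⁿᶠ P ∶ rulesTo R' target → ∃ λ P' → bindRules R' Γ ⊢ⁿᶠ P' ∶ target
  peel-rules [] _ _ dP = _ , dP
  peel-rules (t ∷ ts) ⊆R asm dP with peel asm dP (asm-rule (⊆R (here refl))) (rulesTo-target-no-atom ts)
  ... | _ , _ , dB =
    peel-rules ts (λ mem → ⊆R (there mem)) (assumptions-∷ (asm-rule (⊆R (here refl))) asm) dB

  Γ⋆-admissible : ∀ x → Admissible (lookup Γ⋆ x)
  Γ⋆-admissible = assumptions⇒admissible {Γ = Γ⋆} Γ⋆-assumptions

  typable⇒solvable : ∀ {M : Term 0} → [] ⊢ M ∶ τ⋆ R → Solvable
  typable⇒solvable d with normalise d
  ... | _ , d₀ with peel (λ ()) d₀ asm-σ0 (λ ())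
  ... | _ , _ , d₁ with peel (assumptions-∷ asm-σ0 (λ ())) d₁ asm-σ* (λ ())
  ... | _ , _ , d₂ with peel (assumptions-∷ asm-σ* (assumptions-∷ asm-σ0 (λ ()))) d₂ asm-σ1
                             (rulesTo-target-no-atom R)
  ... | _ , _ , d₃ with peel-rules R (λ mem → mem) Γ₃-assumptions d₃
  ... | _ , dP with marker-lam-view Γ⋆-admissible dP (inj₁ (∋∩-⇒-refl l *)) marker-l
                  | marker-lam-view Γ⋆-admissible dP (inj₂ (inj₁ (∋∩-⇒-refl r #))) marker-r
                  | marker-lam-view Γ⋆-admissible dP (inj₂ (inj₂ (∋∩-⇒-refl • $))) marker-•
  ... | B , refl , dˡ | _ , refl , dʳ | _ , refl , d• = star⇒solvable Γ⋆ Γ⋆-assumptions 1 B columns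
    where
    columns : StarTyped Γ⋆ Γ⋆-assumptions 1 B
    columns zero _ = dˡ
    columns (suc zero) _ = dʳ
    columns (suc (suc zero)) _ = d•
    columns (suc (suc (suc j))) (s≤s (s≤s ()))

module Completeness {m : ℕ} (s0 s1 : Sym m) (R : List (Rule m)) where
  open Encoding s0 s1
  open Columns s0 s1 R
  open Words R
  open Binders s0 s1 R

  retype : ∀ {n} {Δ Δ' : Ctx m n} {M τ τ'} → Δ ≡ Δ' → τ ≡ τ' → Δ ⊢ M ∶ τ → Δ' ⊢ M ∶ τ'
  retype refl refl d = d

  ax-≡ : ∀ {n} {Γ : Ctx m n} {x τ} → lookup Γ x ≡ τ → Γ ⊢ var x ∶ τ
  ax-≡ {x = x} refl = ax x

  ∩E₂ : ∀ {n} {Γ : Ctx m n} {M σ τ} → Γ ⊢ M ∶ σ ∩ τ → Γ ⊢ M ∶ τ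
  ∩E₂ d = ∩E (conv d ∩-comm)

  ⋂E : ∀ {n} {Γ : Ctx m n} {M} k (f : Fin (suc k) → Ty m) e → Γ ⊢ M ∶ ⋂ k f → Γ ⊢ M ∶ f e
  ⋂E zero f zero d = d
  ⋂E (suc k) f zero d = ∩E d
  ⋂E (suc k) f (suc e) d = ⋂E k (λ e' → f (suc e')) e (∩E₂ d)

  column-var-typed : ∀ p j {k T} → lookup Γ⋆ k ≡ T → colCtx p j Γ⋆ ⊢ var (p ↑ʳ k) ∶ T
  column-var-typed p j {k} eq = ax-≡ (trans (lookup-colCtx-↑ʳ p j Γ⋆ k) eq)

  x1 x* x0 : Fin (size R 3)
  x1 = weakenRules R zero
  x* = weakenRules R (suc zero)
  x0 = weakenRules R (suc (suc zero))

  WordTypable : ∀ k → List (Sym m) → Set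
  WordTypable k w = ∃ (Columnwise Γ⋆ _⊢_∶_ k k (λ j → ⟨ symbolAt w j ⟩))

  StarTypable : ℕ → Set
  StarTypable p = ∃ (Columnwise Γ⋆ _⊢_∶_ p (suc p) (λ j → at (goalAtom p j)))

  rule-application-typed : ∀ k {i a b c d w w' κ u Q} → RewriteAt i a b c d w w' →
                           lookup Γ⋆ κ ≡ σRule (a , b , c , d) →
                           (∀ j → lookup (colCtx k j Γ⋆) u ≡ at (colAtom i j)) →
                           Columnwise Γ⋆ _⊢_∶_ k k (λ j → ⟨ symbolAt w' j ⟩) Q →
                           Columnwise Γ⋆ _⊢_∶_ k k (λ j → ⟨ symbolAt w j ⟩) (app (app (var (k ↑ʳ κ)) (var u)) Q)
  rule-application-typed k {i} {w = w} rw κ-type u-type typed j j≤k with j ≟ i | j ≟ suc i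
  ... | yes refl | _ =
    retype refl (cong ⟨_⟩ (≡.sym (old₁ rw)))
      (→E (→E (∩E (column-var-typed k j κ-type)) (ax-≡ (trans (u-type j) (cong at (colAtom-≡ i)))))
          (retype refl (cong ⟨_⟩ (new₁ rw)) (typed j j≤k)))
  ... | no _ | yes refl =
    retype refl (cong ⟨_⟩ (≡.sym (old₂ rw)))
      (→E (→E (∩E (∩E₂ (column-var-typed k j κ-type))) (ax-≡ (trans (u-type j) (cong at (colAtom-suc i)))))
          (retype refl (cong ⟨_⟩ (new₂ rw)) (typed j j≤k)))
  ... | no j≢i | no j≢1+i =
    →E (→E (⋂E m (λ e → • ⇒ ⟨ e ⟩ ⇒ ⟨ e ⟩) (symbolAt w j) (∩E₂ (∩E₂ (column-var-typed k j κ-type))))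
           (ax-≡ (trans (u-type j) (cong at (colAtom-other i j j≢i j≢1+i)))))
       (retype refl (cong ⟨_⟩ (frame rw j j≢i j≢1+i)) (typed j j≤k))

  ↠⇒word-typable : ∀ k w → length w ≡ suc k → R ⊢ w ↠ replicate (suc k) s1 → WordTypable k w
  ↠⇒word-typable k _ _ ε =
    var (k ↑ʳ x1) , λ j j≤k →
      retype refl (cong ⟨_⟩ (≡.sym (symbolAt-replicate (suc k) s1 (s≤s j≤k))))
        (column-var-typed k j (lookup-weakenRules R Γ₃ zero))
  ↠⇒word-typable k _ len (step {a} {b} {c} {d} x y mem ◅ rest) =
    let (Q , typed) = ↠⇒word-typable k _ (trans (length-≡ rw) len) rest
        (κ , κ-type) = rule-index R Γ₃ mem
        (u , u-type) = marker-index Γ⋆ k (length x) (≤-pred (subst (suc (length x) <_) len (in-range rw)))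
    in app (app (var (k ↑ʳ κ)) (var u)) Q , rule-application-typed k rw κ-type u-type typed
    where
    rw : RewriteAt (length x) a b c d (x ++ a ∷ b ∷ y) (x ++ c ∷ d ∷ y)
    rw = rewriteAt-step x y

  σ0-intro : ∀ p → WordTypable (suc p) (replicate (suc (suc p)) s0) → StarTypable p
  σ0-intro p (Q , typed) = app (var (p ↑ʳ x0)) (lam Q) , typed'
    where
    x0-typed : ∀ j → colCtx p j Γ⋆ ⊢ var (p ↑ʳ x0) ∶ σ0
    x0-typed j = column-var-typed p j (lookup-weakenRules R Γ₃ (suc (suc zero)))

    apply : ∀ {j β γ} → j ≤ suc p → colAtom p j ≡ β → goalAtom p j ≡ γ →
            colCtx p j Γ⋆ ⊢ var (p ↑ʳ x0) ∶ (at β ⇒ ⟨ s0 ⟩) ⇒ at γ →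
            colCtx p j Γ⋆ ⊢ app (var (p ↑ʳ x0)) (lam Q) ∶ at (goalAtom p j)
    apply {j} j≤ refl refl dx =
      →E dx (→I (retype refl (cong ⟨_⟩ (symbolAt-replicate _ s0 (s≤s j≤))) (typed j j≤)))

    typed' : Columnwise Γ⋆ _⊢_∶_ p (suc p) (λ j → at (goalAtom p j)) (app (var (p ↑ʳ x0)) (lam Q))
    typed' j j≤ with column-pos p j j≤
    ... | left j<p = apply j≤ (colAtom-< p j j<p) (goalAtom-< p j j<p) (∩E (x0-typed j))
    ... | centre = apply j≤ (colAtom-≡ p) (goalAtom-≡ p) (∩E (∩E₂ (x0-typed p)))
    ... | right = apply j≤ (colAtom-suc p) (goalAtom-suc p) (∩E₂ (∩E₂ (x0-typed (suc p))))

  σ*-intro : ∀ p → StarTypable (suc p) → StarTypable p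
  σ*-intro p (P , typed) = app (var (p ↑ʳ x*)) (lam P) , typed'
    where
    x*-typed : ∀ j → colCtx p j Γ⋆ ⊢ var (p ↑ʳ x*) ∶ σ*
    x*-typed j = column-var-typed p j (lookup-weakenRules R Γ₃ (suc zero))

    body : ∀ {j β γ} → j ≤ suc (suc p) → colAtom p j ≡ β → goalAtom (suc p) j ≡ γ →
           (at β ∷ colCtx p j Γ⋆) ⊢ P ∶ at γ
    body {j} j≤ e e' = retype (cong (λ β → at β ∷ colCtx p j Γ⋆) e) (cong at e') (typed j j≤)

    last-column : (• ∷ colCtx p (suc p) Γ⋆) ⊢ P ∶ $
    last-column =
      retype (cong₂ (λ β Δ → at β ∷ Δ) (colAtom-far p (suc (suc p)) ≤-refl)
                    (colCtx-far Γ⋆ p (suc (suc p)) (suc p) (n≤1+n _) ≤-refl))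
             (cong at (goalAtom-suc (suc p))) (typed (suc (suc p)) ≤-refl)

    typed' : Columnwise Γ⋆ _⊢_∶_ p (suc p) (λ j → at (goalAtom p j)) (app (var (p ↑ʳ x*)) (lam P))
    typed' j j≤ with column-pos p j j≤
    ... | left j<p =
      retype refl (cong at (≡.sym (goalAtom-< p j j<p)))
        (→E (∩E (x*-typed j))
            (→I (body (≤-trans j≤ (n≤1+n _)) (colAtom-< p j j<p) (goalAtom-< (suc p) j (≤-trans j<p (n≤1+n p))))))
    ... | centre =
      retype refl (cong at (≡.sym (goalAtom-≡ p)))
        (→E (∩E (∩E₂ (x*-typed p))) (→I (body (≤-trans j≤ (n≤1+n _)) (colAtom-≡ p) (goalAtom-< (suc p) p ≤-refl))))
    ... | right =
      retype refl (cong at (≡.sym (goalAtom-suc p)))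
        (→E (∩E₂ (∩E₂ (x*-typed (suc p))))
            (∩I (→I (body (n≤1+n _) (colAtom-suc p) (goalAtom-≡ (suc p)))) (→I last-column)))

  σ*-intro-down : ∀ k → StarTypable (suc k) → StarTypable 1
  σ*-intro-down zero t = t
  σ*-intro-down (suc k) t = σ*-intro-down k (σ*-intro (suc k) t)

  lams : ∀ R' {n} → Term (size R' n) → Term n
  lams [] N = N
  lams (_ ∷ ts) N = lam (lams ts N)

  lams-typed : ∀ R' {n} (Γ : Ctx m n) {N τ} → bindRules R' Γ ⊢ N ∶ τ → Γ ⊢ lams R' N ∶ rulesTo R' τ
  lams-typed [] Γ d = d
  lams-typed (t ∷ ts) Γ d = →I (lams-typed ts (σRule t ∷ Γ) d)

  closed-term : StarTypable 1 → ∃ λ (M : Term 0) → [] ⊢ M ∶ τ⋆ R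
  closed-term (P , typed) =
    lam (lam (lam (lams R (lam P)))) ,
    →I (→I (→I (lams-typed R Γ₃
      (∩I (→I (typed 0 z≤n)) (∩I (→I (typed 1 (s≤s z≤n))) (→I (typed 2 (s≤s (s≤s z≤n)))))))))

  tripled-length : ∀ k → suc k + (suc k + suc k) ≡ 3 + (k + (k + k))
  tripled-length k = cong suc (begin
    k + suc (k + suc k)      ≡⟨ +-suc k (k + suc k) ⟩
    suc (k + (k + suc k))    ≡⟨ cong (λ n → suc (k + n)) (+-suc k k) ⟩
    suc (k + suc (k + k))    ≡⟨ cong suc (+-suc k (k + k)) ⟩
    suc (suc (k + (k + k)))  ∎)
    where open ≡.≡-Reasoning

  solvable⇒typable : ∀ n → n ≥ 1 → R ⊢ replicate n s0 ↠ replicate n s1 → ∃ λ (M : Term 0) → [] ⊢ M ∶ τ⋆ R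
  solvable⇒typable (suc k) _ der =
    closed-term (σ*-intro-down K (σ0-intro (suc K)
      (↠⇒word-typable (suc (suc K)) _ (length-replicate _) tripled)))
    where
    K : ℕ
    K = k + (k + k)

    -- the construction needs at least three columns, so the solution is repeated three times
    tripled : R ⊢ replicate (3 + K) s0 ↠ replicate (3 + K) s1
    tripled = subst (λ n → R ⊢ replicate n s0 ↠ replicate n s1) (tripled-length k)
                (↠-replicate-+ (suc k) _ der (↠-replicate-+ (suc k) (suc k) der der))

mainTheorem5 : (m : ℕ) (s0 s1 : Sym m) → s0 ≢ s1 → (R : List (Rule m)) →
    (∃ λ (M : Term 0) → [] ⊢ M ∶ Encoding.τ⋆ s0 s1 R)
      ⇔ (∃ λ (n : ℕ) → n ≥ 1 × (R ⊢ replicate n s0 ↠ replicate n s1))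
mainTheorem5 m s0 s1 _ R =
  mk⇔ (λ (_ , d) → Soundness.typable⇒solvable s0 s1 R d)
      (λ (n , n≥1 , der) → Completeness.solvable⇒typable s0 s1 R n n≥1 der)
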